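{- For any integers $1\leq i\leq n$, the Entringer number $e_{n,i}$ equals the number of total cyclic orders $Z$ on $[n+1]$ such that (1) $(j,j+1,j+2)\in Z$ for every $1\leq j\leq n-1$, and (2) $i=1+c_Z(n,n+1)$ if $n$ is odd, and $i=1+c_Z(n+1,n)$ if $n$ is even.
   Context: A total cyclic order on a finite set $X$ is a set $Z$ of triples of distinct elements of $X$ such that: $(x,y,z)\in Z\Rightarrow (y,z,x)\in Z$; $(x,y,z)\in Z\Rightarrow (z,y,x)\notin Z$; $(x,y,z)\in Z$ and $(x,z,u)\in Z\Rightarrow (x,y,u)\in Z$; and for any three distinct $x,y,z$, either $(x,y,z)\in Z$ or $(z,y,x)\in Z$. For a total cyclic order $Z$ on $[m]$ and distinct $a,b\in[m]$, the content is $c_Z(a,b)=\#\{x\in[m]:(a,x,b)\in Z\}$. A permutation $\sigma$ of $[n]$ is up/down if $\sigma(1)<\sigma(2)>\sigma(3)<\sigma(4)>\cdots$ (ascent at each odd position $j$, i.e. $\sigma(j)<\sigma(j+1)$, descent at each even position). The Entringer number $e_{n,i}$ is the number of up/down permutations $\sigma$ of $[n]$ with $\sigma(n)=i$. -}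

module Defs where

open import Data.Bool using (Bool; true; false; T)
open import Data.Bool.Properties using (T?)
open import Data.Nat using (ℕ; zero; suc; _+_; _≤_; _%_)
open import Data.Nat.Properties using (_≟_; _≤?_)
open import Data.Fin using (Fin; toℕ) renaming (_<_ to _<ᶠ_; _>_ to _>ᶠ_)
import Data.Fin.Properties as FinP
open import Data.List using (List; []; _∷_; map; concatMap; length; filter)
open import Data.Vec using (Vec; []; _∷_; lookup; allFin)
import Data.Vec as Vec
open import Data.Product using (_×_; _,_)
open import Data.Sum using (_⊎_)
open import Relation.Nullary using (¬_; Dec)
open import Relation.Nullary.Decidable using (_×-dec_; _⊎-dec_; _→-dec_; ¬?)
open import Relation.Binary.PropositionalEquality using (_≡_)

allVecs : ∀ {a} {A : Set a} → List A → (k : ℕ) → List (Vec A k)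
allVecs xs zero    = [] ∷ []
allVecs xs (suc k) = concatMap (λ x → map (x ∷_) (allVecs xs k)) xs

allFinList : (n : ℕ) → List (Fin n)
allFinList n = Vec.toList (allFin n)

-- The set [n] = {1,…,n} is encoded as Fin n (element k ↦ toℕ k + 1);
-- positions 1,…,n likewise.

IsPerm : {n : ℕ} → Vec (Fin n) n → Set
IsPerm {n} σ = (p q : Fin n) → lookup σ p ≡ lookup σ q → p ≡ q

-- up/down: ascent at odd (1-based) positions, descent at even ones.
-- 1-based position j = toℕ p + 1 is odd iff toℕ p % 2 ≡ 0.
IsUpDown : {n : ℕ} → Vec (Fin n) n → Set
IsUpDown {n} σ = (p q : Fin n) → toℕ q ≡ suc (toℕ p) →
  (toℕ p % 2 ≡ 0 → lookup σ p <ᶠ lookup σ q) ×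
  (¬ (toℕ p % 2 ≡ 0) → lookup σ p >ᶠ lookup σ q)

LastIs : {n : ℕ} → Vec (Fin n) n → ℕ → Set
LastIs {n} σ i = (p : Fin n) → suc (toℕ p) ≡ n → suc (toℕ (lookup σ p)) ≡ i

EntringerPred : (n i : ℕ) → Vec (Fin n) n → Set
EntringerPred n i σ = IsPerm σ × IsUpDown σ × LastIs σ i

entringerPred? : (n i : ℕ) → (σ : Vec (Fin n) n) → Dec (EntringerPred n i σ)
entringerPred? n i σ =
  FinP.all? (λ p → FinP.all? (λ q → (lookup σ p FinP.≟ lookup σ q) →-dec (p FinP.≟ q)))
  ×-dec
  FinP.all? (λ p → FinP.all? (λ q → (toℕ q ≟ suc (toℕ p)) →-dec
     (((toℕ p % 2 ≟ 0) →-dec (lookup σ p FinP.<? lookup σ q)) ×-dec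
      (¬? (toℕ p % 2 ≟ 0) →-dec (lookup σ q FinP.<? lookup σ p)))))
  ×-dec
  FinP.all? (λ p → (suc (toℕ p) ≟ n) →-dec (suc (toℕ (lookup σ p)) ≟ i))

entringer : ℕ → ℕ → ℕ
entringer n i = length (filter (entringerPred? n i) (allVecs (allFinList n) n))

-- Ternary relations on [m] (encoded as Fin m), as finite Boolean tables,
-- so that a set Z of triples is a concrete finite object and can be counted.

Ternary : ℕ → Set
Ternary m = Vec (Vec (Vec Bool m) m) m

_∋⟨_,_,_⟩ : {m : ℕ} → Ternary m → Fin m → Fin m → Fin m → Set
Z ∋⟨ x , y , z ⟩ = T (lookup (lookup (lookup Z x) y) z)

OnlyDistinct : {m : ℕ} → Ternary m → Set
OnlyDistinct {m} Z = (x y z : Fin m) → Z ∋⟨ x , y , z ⟩ →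
  ¬ (x ≡ y) × ¬ (y ≡ z) × ¬ (x ≡ z)

Cyclic : {m : ℕ} → Ternary m → Set
Cyclic {m} Z = (x y z : Fin m) → Z ∋⟨ x , y , z ⟩ → Z ∋⟨ y , z , x ⟩

Asymmetric : {m : ℕ} → Ternary m → Set
Asymmetric {m} Z = (x y z : Fin m) → Z ∋⟨ x , y , z ⟩ → ¬ (Z ∋⟨ z , y , x ⟩)

Transitive : {m : ℕ} → Ternary m → Set
Transitive {m} Z = (x y z u : Fin m) → Z ∋⟨ x , y , z ⟩ → Z ∋⟨ x , z , u ⟩ → Z ∋⟨ x , y , u ⟩

Total : {m : ℕ} → Ternary m → Set
Total {m} Z = (x y z : Fin m) → ¬ (x ≡ y) → ¬ (y ≡ z) → ¬ (x ≡ z) →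
  Z ∋⟨ x , y , z ⟩ ⊎ Z ∋⟨ z , y , x ⟩

IsTotalCyclicOrder : {m : ℕ} → Ternary m → Set
IsTotalCyclicOrder Z = OnlyDistinct Z × Cyclic Z × Asymmetric Z × Transitive Z × Total Z

content : {m : ℕ} → Ternary m → Fin m → Fin m → ℕ
content {m} Z a b = length (filter (λ x → T? (lookup (lookup (lookup Z a) x) b)) (allFinList m))

Cond1 : {n : ℕ} → Ternary (suc n) → Set
Cond1 {n} Z = (a b c : Fin (suc n)) → toℕ b ≡ suc (toℕ a) → toℕ c ≡ suc (toℕ b) →
  Z ∋⟨ a , b , c ⟩

-- a encodes the element n, b encodes the element n+1.
Cond2 : {n : ℕ} → ℕ → Ternary (suc n) → Set
Cond2 {n} i Z = (a b : Fin (suc n)) → suc (toℕ a) ≡ n → suc (toℕ b) ≡ suc n →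
  (n % 2 ≡ 1 → i ≡ 1 + content Z a b) ×
  (n % 2 ≡ 0 → i ≡ 1 + content Z b a)

CycPred : (n i : ℕ) → Ternary (suc n) → Set
CycPred n i Z = IsTotalCyclicOrder Z × Cond1 Z × Cond2 i Z

private
  ∈? : {m : ℕ} (Z : Ternary m) (x y z : Fin m) → Dec (Z ∋⟨ x , y , z ⟩)
  ∈? Z x y z = T? (lookup (lookup (lookup Z x) y) z)

  all3 : {m : ℕ} {P : Fin m → Fin m → Fin m → Set} →
         ((x y z : Fin m) → Dec (P x y z)) → Dec ((x y z : Fin m) → P x y z)
  all3 P? = FinP.all? (λ x → FinP.all? (λ y → FinP.all? (λ z → P? x y z)))

cycPred? : (n i : ℕ) → (Z : Ternary (suc n)) → Dec (CycPred n i Z)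
cycPred? n i Z =
  ( all3 (λ x y z → ∈? Z x y z →-dec
        (¬? (x FinP.≟ y) ×-dec ¬? (y FinP.≟ z) ×-dec ¬? (x FinP.≟ z)))
    ×-dec all3 (λ x y z → ∈? Z x y z →-dec ∈? Z y z x)
    ×-dec all3 (λ x y z → ∈? Z x y z →-dec ¬? (∈? Z z y x))
    ×-dec all3 (λ x y z → FinP.all? (λ u → ∈? Z x y z →-dec ∈? Z x z u →-dec ∈? Z x y u))
    ×-dec all3 (λ x y z → ¬? (x FinP.≟ y) →-dec ¬? (y FinP.≟ z) →-dec ¬? (x FinP.≟ z) →-dec
                 (∈? Z x y z ⊎-dec ∈? Z z y x)))
  ×-dec all3 (λ a b c → (toℕ b ≟ suc (toℕ a)) →-dec (toℕ c ≟ suc (toℕ b)) →-dec ∈? Z a b c)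
  ×-dec FinP.all? (λ a → FinP.all? (λ b → (suc (toℕ a) ≟ n) →-dec (suc (toℕ b) ≟ suc n) →-dec
          (((n % 2 ≟ 1) →-dec (i ≟ 1 + content Z a b)) ×-dec
           ((n % 2 ≟ 0) →-dec (i ≟ 1 + content Z b a)))))

allTernary : (m : ℕ) → List (Ternary m)
allTernary m = allVecs (allVecs (allVecs (true ∷ false ∷ []) m) m) m

cyclicCount : ℕ → ℕ → ℕ
cyclicCount n i = length (filter (cycPred? n i) (allTernary (suc n)))

-- Both counts obey the Entringer recurrence X (n + 1) i = Σ_{j ≤ n} [Admissible n j i] X n j
-- and agree for n = 1.  For permutations, deleting the last entry and standardising the rest
-- is a bijection onto the pairs (j, τ) with τ counted by e_{n,j} and (j, i) admissible,
-- since the last step is an ascent exactly when n is odd.  For cyclic orders, restriction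
-- from [n + 2] to [n + 1] plays the same role.  Condition (1) gives the triple
-- (n, n + 1, n + 2), which compares the content defining i with the one defining j.  A total
-- cyclic order is determined by the linear order it induces when read from n + 1, and there
-- i pins down the position of n + 2, so restriction is injective.  Conversely, every
-- admissible position is realised by integer keys: the contents read from n + 1, doubled,
-- key the smaller order, and n + 2 receives an odd key just below that of its successor.

module Submission where

open import Defs
open import Data.Bool using (Bool; true; false; T)
open import Data.Bool.Properties using (T?)
open import Data.Empty using (⊥-elim)
open import Data.Fin using (Fin; toℕ; inject₁; fromℕ; fromℕ<; punchIn; punchOut) renaming (_<_ to _<ᶠ_)
import Data.Fin as Fin
open import Data.Fin.Properties
  using (toℕ-injective; toℕ<n; toℕ-fromℕ; toℕ-fromℕ<; toℕ-inject₁; inject₁-injective; fromℕ≢inject₁;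
         punchIn-injective; punchInᵢ≢i; punchIn-punchOut; punchIn-mono-≤; punchIn-cancel-≤;
         punchOut-injective; injective⇒≤; any?)
  renaming (_≟_ to _≟ᶠ_)
open import Data.Fin.Relation.Unary.Top using (view; ‵fromℕ; ‵inject₁; view-inject₁; view-fromℕ)
open import Data.List using (List; []; _∷_; [_]; map; filter; length; _++_; concatMap; upTo)
import Data.List as List
open import Data.List.Membership.Propositional using (_∈_)
open import Data.List.Membership.Propositional.Properties
  using (∈-∃++; ∈-filter⁺; ∈-map⁺; ∈-map⁻; ∈-++⁺ˡ; ∈-++⁺ʳ; ∈-++⁻; ∈-allFin; ∈-upTo⁺)
open import Data.List.Properties using (length-++; filter-none; length-filter; map-tabulate; length-tabulate; map-cong)
open import Data.List.Relation.Unary.All using (All; []; _∷_)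
import Data.List.Relation.Unary.All as All
open import Data.List.Relation.Unary.All.Properties using (all-filter; All¬⇒¬Any)
open import Data.List.Relation.Unary.AllPairs using ([]; _∷_)
open import Data.List.Relation.Unary.Any using (here; there)
open import Data.List.Relation.Unary.Unique.Propositional using (Unique)
import Data.List.Relation.Unary.Unique.Propositional.Properties as Unique
open import Data.Nat using (ℕ; zero; suc; pred; _+_; _≤_; _<_; _%_; z≤n; s≤s; >-nonZero)
open import Data.Nat.DivMod using ([m+n]%n≡m%n)
open import Data.Nat.ListAction using (sum)
open import Data.Nat.Properties
  using (_≟_; _<?_; _≤?_; ≤-refl; ≤-reflexive; ≤-antisym; ≤-trans; ≤-pred; <-trans; <-asym; <-irrefl; <-cmp;
         <⇒≢; <⇒≤; <⇒≱; ≰⇒>; ≮⇒≥; ≤-<-trans; <-≤-trans; ≤∧≢⇒<; n≤1+n; n<1+n; m≤n⇒m≤1+n; m≤m+n;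
         suc-injective; suc-pred; pred-mono-≤; 0≢1+n; 1+n≢0; 1+n≢n; 1+n≰n; +-comm; +-suc; +-identityʳ; +-monoˡ-≤)
open import Data.Product using (Σ; _×_; _,_; proj₁; proj₂)
open import Data.Sum using (_⊎_; inj₁; inj₂)
open import Data.Vec using (Vec; []; _∷_; lookup; tabulate; _∷ʳ_)
import Data.Vec as Vec
import Data.Vec.Properties as Vec
open import Function using (_∘_)
open import Relation.Binary using (tri<; tri≈; tri>)
open import Relation.Binary.PropositionalEquality
  using (_≡_; _≢_; refl; sym; trans; cong; cong₂; subst; subst₂; module ≡-Reasoning)
open import Relation.Nullary using (¬_; Dec; yes; no)
open import Relation.Nullary.Decidable using (_⊎-dec_; _×-dec_; isYes; toWitness; fromWitness)
open import Relation.Binary.Definitions using (DecidableEquality)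
open import Relation.Unary using (Decidable)

private variable
  A B : Set

-- Counting over lists

count : {P : A → Set} → Decidable P → List A → ℕ
count P? xs = length (filter P? xs)

count-mono : {P Q : A → Set} (P? : Decidable P) (Q? : Decidable Q) →
  (∀ x → P x → Q x) → ∀ xs → count P? xs ≤ count Q? xs
count-mono P? Q? P⇒Q [] = z≤n
count-mono P? Q? P⇒Q (x ∷ xs) with P? x | Q? x
... | yes _ | yes _ = s≤s (count-mono P? Q? P⇒Q xs)
... | yes p | no ¬q = ⊥-elim (¬q (P⇒Q x p))
... | no _  | yes _ = m≤n⇒m≤1+n (count-mono P? Q? P⇒Q xs)
... | no _  | no _  = count-mono P? Q? P⇒Q xs

count-< : {P Q : A → Set} (P? : Decidable P) (Q? : Decidable Q) →
  (∀ x → P x → Q x) → ∀ {y} xs → y ∈ xs → Q y → ¬ P y → count P? xs < count Q? xs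
count-< P? Q? P⇒Q (x ∷ xs) (here refl) qy ¬py with P? x | Q? x
... | yes px | _     = ⊥-elim (¬py px)
... | no _   | no ¬q = ⊥-elim (¬q qy)
... | no _   | yes _ = s≤s (count-mono P? Q? P⇒Q xs)
count-< P? Q? P⇒Q (x ∷ xs) (there y∈xs) qy ¬py with P? x | Q? x
... | yes _ | yes _ = s≤s (count-< P? Q? P⇒Q xs y∈xs qy ¬py)
... | yes p | no ¬q = ⊥-elim (¬q (P⇒Q x p))
... | no _  | yes _ = m≤n⇒m≤1+n (count-< P? Q? P⇒Q xs y∈xs qy ¬py)
... | no _  | no _  = count-< P? Q? P⇒Q xs y∈xs qy ¬py

count-cong : {P Q : A → Set} (P? : Decidable P) (Q? : Decidable Q) →
  (∀ x → P x → Q x) → (∀ x → Q x → P x) → ∀ xs → count P? xs ≡ count Q? xs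
count-cong P? Q? P⇒Q Q⇒P xs = ≤-antisym (count-mono P? Q? P⇒Q xs) (count-mono Q? P? Q⇒P xs)

module _ {P : A → Set} (P? : Decidable P) where

  count-++ : ∀ xs ys → count P? (xs ++ ys) ≡ count P? xs + count P? ys
  count-++ [] ys = refl
  count-++ (x ∷ xs) ys with P? x
  ... | yes _ = cong suc (count-++ xs ys)
  ... | no _  = count-++ xs ys

  count-map : (f : B → A) → ∀ xs → count P? (map f xs) ≡ count (P? ∘ f) xs
  count-map f [] = refl
  count-map f (x ∷ xs) with P? (f x)
  ... | yes _ = cong suc (count-map f xs)
  ... | no _  = count-map f xs

  count-none : ∀ {xs} → All (¬_ ∘ P) xs → count P? xs ≡ 0
  count-none ¬Ps = cong length (filter-none P? ¬Ps)

  count-singleton-≤-1 : ∀ x → count P? [ x ] ≤ 1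
  count-singleton-≤-1 x with P? x
  ... | yes _ = s≤s z≤n
  ... | no _  = z≤n

  count-singleton-≡-0 : ∀ x → ¬ P x → count P? [ x ] ≡ 0
  count-singleton-≡-0 x ¬px with P? x
  ... | yes px = ⊥-elim (¬px px)
  ... | no _   = refl

count-⊎ : {P Q : A → Set} (P? : Decidable P) (Q? : Decidable Q) → (∀ x → P x → ¬ Q x) →
  ∀ xs → count (λ x → P? x ⊎-dec Q? x) xs ≡ count P? xs + count Q? xs
count-⊎ P? Q? disjoint [] = refl
count-⊎ P? Q? disjoint (x ∷ xs) with P? x | Q? x
... | yes p | yes q = ⊥-elim (disjoint x p q)
... | yes _ | no _  = cong suc (count-⊎ P? Q? disjoint xs)
... | no _  | yes _ = trans (cong suc (count-⊎ P? Q? disjoint xs)) (sym (+-suc _ _))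
... | no _  | no _  = count-⊎ P? Q? disjoint xs

count-≡-1 : (_≟_ : DecidableEquality A) (q : A) → ∀ xs → Unique xs → q ∈ xs → count (_≟ q) xs ≡ 1
count-≡-1 _≟_ q (x ∷ xs) (x∉xs ∷ _) (here refl) with x ≟ x
... | no x≢x = ⊥-elim (x≢x refl)
... | yes _  = cong suc (count-none (_≟ x) (All.map (λ x≢y y≡x → x≢y (sym y≡x)) x∉xs))
count-≡-1 _≟_ q (x ∷ xs) (x∉xs ∷ u) (there q∈xs) with x ≟ q
... | yes refl = ⊥-elim (All¬⇒¬Any x∉xs q∈xs)
... | no _     = count-≡-1 _≟_ q xs u q∈xs

private
  ∈-++-∷⇒∈-++ : ∀ {z x : A} us vs → z ∈ us ++ x ∷ vs → z ≢ x → z ∈ us ++ vs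
  ∈-++-∷⇒∈-++ []       vs (here refl) z≢x = ⊥-elim (z≢x refl)
  ∈-++-∷⇒∈-++ []       vs (there z∈)  z≢x = z∈
  ∈-++-∷⇒∈-++ (u ∷ us) vs (here refl) z≢x = here refl
  ∈-++-∷⇒∈-++ (u ∷ us) vs (there z∈)  z≢x = there (∈-++-∷⇒∈-++ us vs z∈ z≢x)

unique-⊆⇒length-≤ : ∀ (xs ys : List A) → Unique xs → (∀ {z} → z ∈ xs → z ∈ ys) →
  length xs ≤ length ys
unique-⊆⇒length-≤ [] ys _ _ = z≤n
unique-⊆⇒length-≤ (x ∷ xs) ys (x∉xs ∷ u) xs⊆ys with ∈-∃++ (xs⊆ys (here refl))
... | us , vs , refl = subst (suc (length xs) ≤_) (sym length-us++x∷vs) (s≤s rest)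
  where
  rest : length xs ≤ length (us ++ vs)
  rest = unique-⊆⇒length-≤ xs (us ++ vs) u
    (λ z∈xs → ∈-++-∷⇒∈-++ us vs (xs⊆ys (there z∈xs)) (λ { refl → All¬⇒¬Any x∉xs z∈xs }))
  length-us++x∷vs : length (us ++ x ∷ vs) ≡ suc (length (us ++ vs))
  length-us++x∷vs = begin
    length (us ++ x ∷ vs)        ≡⟨ length-++ us ⟩
    length us + suc (length vs)  ≡⟨ +-suc (length us) (length vs) ⟩
    suc (length us + length vs)  ≡⟨ cong suc (length-++ us) ⟨
    suc (length (us ++ vs))      ∎
    where open ≡-Reasoning

module _ {P : A → Set} {Q : B → Set} (P? : Decidable P) (Q? : Decidable Q)
  {xs : List A} {ys : List B} (xs-unique : Unique xs)
  (f : ∀ a → P a → B) (f-∈ : ∀ a p → f a p ∈ ys) (f-Q : ∀ a p → Q (f a p))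
  (f-injective : ∀ a a' p p' → f a p ≡ f a' p' → a ≡ a') where

  private
    mapAll : (L : List A) → All P L → List B
    mapAll []      []       = []
    mapAll (a ∷ L) (p ∷ ps) = f a p ∷ mapAll L ps

    length-mapAll : ∀ L ps → length (mapAll L ps) ≡ length L
    length-mapAll []      []       = refl
    length-mapAll (a ∷ L) (p ∷ ps) = cong suc (length-mapAll L ps)

    ∈-mapAll⁻ : ∀ L ps {b} → b ∈ mapAll L ps → Σ A λ a → Σ (P a) λ p → b ≡ f a p
    ∈-mapAll⁻ (a ∷ L) (p ∷ ps) (here refl) = a , p , refl
    ∈-mapAll⁻ (a ∷ L) (p ∷ ps) (there b∈)  = ∈-mapAll⁻ L ps b∈

    mapAll-unique : ∀ L ps → Unique L → Unique (mapAll L ps)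
    mapAll-unique []      []       _           = []
    mapAll-unique (a ∷ L) (p ∷ ps) (a∉L ∷ u) = fresh L ps a∉L ∷ mapAll-unique L ps u
      where
      fresh : ∀ L ps → All (a ≢_) L → All (f a p ≢_) (mapAll L ps)
      fresh []       []         []          = []
      fresh (a' ∷ L) (p' ∷ ps) (a≢a' ∷ a∉) = (a≢a' ∘ f-injective a a' p p') ∷ fresh L ps a∉

  count-≤-by-injection : count P? xs ≤ count Q? ys
  count-≤-by-injection = subst (_≤ count Q? ys) (length-mapAll L ps)
    (unique-⊆⇒length-≤ (mapAll L ps) (filter Q? ys) (mapAll-unique L ps (Unique.filter⁺ P? xs-unique)) ⊆Q)
    where
    L  = filter P? xs
    ps = all-filter P? xs
    ⊆Q : ∀ {z} → z ∈ mapAll L ps → z ∈ filter Q? ys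
    ⊆Q z∈ with ∈-mapAll⁻ L ps z∈
    ... | a , p , refl = ∈-filter⁺ Q? (f-∈ a p) (f-Q a p)

pairs : List A → List B → List (A × B)
pairs xs ys = concatMap (λ x → map (x ,_) ys) xs

∈-pairs : ∀ {x : A} {y : B} xs ys → x ∈ xs → y ∈ ys → (x , y) ∈ pairs xs ys
∈-pairs (x ∷ xs) ys (here refl) y∈ = ∈-++⁺ˡ (∈-map⁺ (x ,_) y∈)
∈-pairs (x ∷ xs) ys (there x∈)  y∈ = ∈-++⁺ʳ (map (x ,_) ys) (∈-pairs xs ys x∈ y∈)

∈-pairs⁻ : ∀ {x : A} {y : B} xs ys → (x , y) ∈ pairs xs ys → x ∈ xs
∈-pairs⁻ (x' ∷ xs) ys xy∈ with ∈-++⁻ (map (x' ,_) ys) xy∈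
... | inj₂ xy∈pairs = there (∈-pairs⁻ xs ys xy∈pairs)
... | inj₁ xy∈map with ∈-map⁻ _ xy∈map
...   | _ , _ , refl = here refl

pairs-unique : ∀ (xs : List A) (ys : List B) → Unique xs → Unique ys → Unique (pairs xs ys)
pairs-unique [] ys _ _ = []
pairs-unique (x ∷ xs) ys (x∉xs ∷ uxs) uys =
  Unique.++⁺ (Unique.map⁺ (cong proj₂) uys) (pairs-unique xs ys uxs uys) disjoint
  where
  disjoint : ∀ {v} → ¬ (v ∈ map (x ,_) ys × v ∈ pairs xs ys)
  disjoint (v∈map , v∈pairs) with ∈-map⁻ _ v∈map
  ... | _ , _ , refl = All¬⇒¬Any x∉xs (∈-pairs⁻ xs ys v∈pairs)

count-pairs : {P : A → Set} (P? : Decidable P) {Q : A → B → Set} (Q? : ∀ x → Decidable (Q x)) →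
  ∀ xs ys → count (λ xy → P? (proj₁ xy) ×-dec Q? (proj₁ xy) (proj₂ xy)) (pairs xs ys)
          ≡ sum (map (λ x → count (Q? x) ys) (filter P? xs))
count-pairs P? Q? [] ys = refl
count-pairs P? Q? (x ∷ xs) ys
  rewrite count-++ (λ xy → P? (proj₁ xy) ×-dec Q? (proj₁ xy) (proj₂ xy)) (map (x ,_) ys) (pairs xs ys)
        | count-map (λ xy → P? (proj₁ xy) ×-dec Q? (proj₁ xy) (proj₂ xy)) (x ,_) ys
        | count-pairs P? Q? xs ys
  with P? x
... | yes px = cong (_+ _) (count-cong (λ y → yes px ×-dec Q? x y) (Q? x) (λ _ → proj₂) (λ _ q → px , q) ys)
... | no ¬px = cong (_+ _) (count-none (λ y → no ¬px ×-dec Q? x y) {ys} (All.tabulate (λ _ → ¬px ∘ proj₁)))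

-- Enumerations

oneTo : ℕ → List ℕ
oneTo n = map suc (upTo n)

∈-oneTo : ∀ {m n} → m < n → suc m ∈ oneTo n
∈-oneTo m<n = ∈-map⁺ suc (∈-upTo⁺ m<n)

oneTo-unique : ∀ n → Unique (oneTo n)
oneTo-unique n = Unique.map⁺ suc-injective (Unique.upTo⁺ n)

allFinList≡allFin : ∀ m → allFinList m ≡ List.allFin m
allFinList≡allFin m = toList-tabulate (λ x → x)
  where
  toList-tabulate : ∀ {n} (f : Fin n → A) → Vec.toList (tabulate f) ≡ List.tabulate f
  toList-tabulate {n = zero}  f = refl
  toList-tabulate {n = suc n} f = cong (f Fin.zero ∷_) (toList-tabulate (f ∘ Fin.suc))

allFinList-unique : ∀ m → Unique (allFinList m)
allFinList-unique m = subst Unique (sym (allFinList≡allFin m)) (Unique.allFin⁺ m)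

∈-allFinList : ∀ {m} (x : Fin m) → x ∈ allFinList m
∈-allFinList {m} x = subst (x ∈_) (sym (allFinList≡allFin m)) (∈-allFin x)

length-allFinList : ∀ m → length (allFinList m) ≡ m
length-allFinList m = trans (cong length (allFinList≡allFin m)) (length-tabulate (λ x → x))

allFinList-suc : ∀ m → allFinList (suc m) ≡ map inject₁ (allFinList m) ++ [ fromℕ m ]
allFinList-suc m = begin
  allFinList (suc m)                                 ≡⟨ allFinList≡allFin (suc m) ⟩
  List.tabulate (λ x → x)                            ≡⟨ tabulate-∷ʳ (λ x → x) ⟩
  List.tabulate inject₁ ++ [ fromℕ m ]               ≡⟨ cong (_++ [ fromℕ m ]) (map-tabulate (λ x → x) inject₁) ⟨
  map inject₁ (List.allFin m) ++ [ fromℕ m ]         ≡⟨ cong (λ xs → map inject₁ xs ++ [ fromℕ m ]) (allFinList≡allFin m) ⟨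
  map inject₁ (allFinList m) ++ [ fromℕ m ]          ∎
  where
  open ≡-Reasoning
  tabulate-∷ʳ : ∀ {m} (f : Fin (suc m) → A) → List.tabulate f ≡ List.tabulate (f ∘ inject₁) ++ [ f (fromℕ m) ]
  tabulate-∷ʳ {m = zero}  f = refl
  tabulate-∷ʳ {m = suc m} f = cong (f Fin.zero ∷_) (tabulate-∷ʳ (f ∘ Fin.suc))

count-allFinList-suc : ∀ {m} {P : Fin (suc m) → Set} (P? : Decidable P) →
  count P? (allFinList (suc m)) ≡ count (P? ∘ inject₁) (allFinList m) + count P? [ fromℕ m ]
count-allFinList-suc {m} P? = begin
  count P? (allFinList (suc m))
    ≡⟨ cong (count P?) (allFinList-suc m) ⟩
  count P? (map inject₁ (allFinList m) ++ [ fromℕ m ])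
    ≡⟨ count-++ P? (map inject₁ (allFinList m)) _ ⟩
  count P? (map inject₁ (allFinList m)) + count P? [ fromℕ m ]
    ≡⟨ cong (_+ count P? [ fromℕ m ]) (count-map P? inject₁ (allFinList m)) ⟩
  count (P? ∘ inject₁) (allFinList m) + count P? [ fromℕ m ] ∎
  where open ≡-Reasoning

∈-allVecs : ∀ {xs : List A} → (∀ a → a ∈ xs) → ∀ {k} (v : Vec A k) → v ∈ allVecs xs k
∈-allVecs all∈ [] = here refl
∈-allVecs {xs = xs} all∈ {suc k} (x ∷ v) = go xs (all∈ x)
  where
  go : ∀ ys → x ∈ ys → (x ∷ v) ∈ concatMap (λ y → map (y ∷_) (allVecs xs k)) ys
  go (y ∷ ys) (here refl) = ∈-++⁺ˡ (∈-map⁺ (x ∷_) (∈-allVecs all∈ v))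
  go (y ∷ ys) (there x∈)  = ∈-++⁺ʳ (map (y ∷_) (allVecs xs k)) (go ys x∈)

allVecs-unique : ∀ {A : Set} {xs : List A} → Unique xs → ∀ k → Unique (allVecs xs k)
allVecs-unique u zero = [] ∷ []
allVecs-unique {A} {xs} u (suc k) = go xs u
  where
  extend : List A → List (Vec A (suc k))
  extend = concatMap (λ y → map (y ∷_) (allVecs xs k))
  head∈ : ∀ {x v} ys → (x ∷ v) ∈ extend ys → x ∈ ys
  head∈ (y ∷ ys) xv∈ with ∈-++⁻ (map (y ∷_) (allVecs xs k)) xv∈
  ... | inj₂ xv∈rest = there (head∈ ys xv∈rest)
  ... | inj₁ xv∈map with ∈-map⁻ _ xv∈map
  ...   | _ , _ , refl = here refl
  go : ∀ ys → Unique ys → Unique (extend ys)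
  go [] _ = []
  go (y ∷ ys) (y∉ys ∷ uys) =
    Unique.++⁺ (Unique.map⁺ Vec.∷-injectiveʳ (allVecs-unique u k)) (go ys uys) disjoint
    where
    disjoint : ∀ {v} → ¬ (v ∈ map (y ∷_) (allVecs xs k) × v ∈ extend ys)
    disjoint (v∈map , v∈rest) with ∈-map⁻ _ v∈map
    ... | _ , _ , refl = All¬⇒¬Any y∉ys (head∈ ys v∈rest)

private
  ∈-bools : ∀ b → b ∈ true ∷ false ∷ []
  ∈-bools true  = here refl
  ∈-bools false = there (here refl)

  bools-unique : Unique (true ∷ false ∷ [])
  bools-unique = ((λ ()) ∷ []) ∷ ([] ∷ [])

∈-allTernary : ∀ {m} (Z : Ternary m) → Z ∈ allTernary m
∈-allTernary = ∈-allVecs (∈-allVecs (∈-allVecs ∈-bools))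

allTernary-unique : ∀ m → Unique (allTernary m)
allTernary-unique m = allVecs-unique (allVecs-unique (allVecs-unique bools-unique m) m) m

∈-allVecsFin : ∀ {n} (σ : Vec (Fin n) n) → σ ∈ allVecs (allFinList n) n
∈-allVecsFin = ∈-allVecs ∈-allFinList

allVecsFin-unique : ∀ n → Unique (allVecs (allFinList n) n)
allVecsFin-unique n = allVecs-unique (allFinList-unique n) n

lookup-extensionality : ∀ {k} {u v : Vec A k} → (∀ i → lookup u i ≡ lookup v i) → u ≡ v
lookup-extensionality {u = u} {v} u≗v =
  trans (sym (Vec.tabulate∘lookup u)) (trans (Vec.tabulate-cong u≗v) (Vec.tabulate∘lookup v))

≡-by-toℕ : ∀ {m} {a b : Fin m} {t} → suc (toℕ a) ≡ t → suc (toℕ b) ≡ t → a ≡ b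
≡-by-toℕ 1+a≡t 1+b≡t = toℕ-injective (suc-injective (trans 1+a≡t (sym 1+b≡t)))

-- The Entringer recurrence

private
  %2-suc-suc : ∀ n → suc (suc n) % 2 ≡ n % 2
  %2-suc-suc n = trans (cong (_% 2) (+-comm 2 n)) ([m+n]%n≡m%n n 2)

parity : ∀ n → (n % 2 ≡ 0 × suc n % 2 ≡ 1) ⊎ (n % 2 ≡ 1 × suc n % 2 ≡ 0)
parity zero = inj₁ (refl , refl)
parity (suc n) with parity n
... | inj₁ (n-even , 1+n-odd) = inj₂ (1+n-odd , trans (%2-suc-suc n) n-even)
... | inj₂ (n-odd , 1+n-even) = inj₁ (1+n-even , trans (%2-suc-suc n) n-odd)

even≢odd : ∀ n → n % 2 ≡ 0 → n % 2 ≡ 1 → {A : Set} → A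
even≢odd n n-even n-odd = ⊥-elim (0≢1+n (trans (sym n-even) n-odd))

-- The step from position n to n + 1 of an up/down permutation is an ascent
-- exactly when n is odd, whence e (n + 1) i = Σ [Admissible n j i] e n j.
Admissible : ℕ → ℕ → ℕ → Set
Admissible n j i = (n % 2 ≡ 1 × j < i × i ≤ suc n) ⊎ (n % 2 ≡ 0 × 1 ≤ i × i ≤ j)

admissible? : ∀ n j i → Dec (Admissible n j i)
admissible? n j i =
  ((n % 2 ≟ 1) ×-dec (j <? i) ×-dec (i ≤? suc n)) ⊎-dec ((n % 2 ≟ 0) ×-dec (1 ≤? i) ×-dec (i ≤? j))

admissible-bounds : ∀ {n j i} → Admissible n j i → j ≤ n → 1 ≤ i × i ≤ suc n
admissible-bounds (inj₁ (_ , j<i , i≤1+n)) _   = ≤-trans (s≤s z≤n) j<i , i≤1+n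
admissible-bounds (inj₂ (_ , 1≤i , i≤j))   j≤n = 1≤i , ≤-trans i≤j (≤-trans j≤n (n≤1+n _))

nextRow : (ℕ → ℕ) → ℕ → ℕ → ℕ
nextRow e n i = sum (map e (filter (λ j → admissible? n j i) (oneTo n)))

nextRow-cong : ∀ {e e′} → (∀ j → e j ≡ e′ j) → ∀ n i → nextRow e n i ≡ nextRow e′ n i
nextRow-cong e≗e′ n i = cong sum (map-cong e≗e′ (filter (λ j → admissible? n j i) (oneTo n)))

-- Total cyclic orders

ent : ∀ {m} → Ternary m → Fin m → Fin m → Fin m → Bool
ent Z x y z = lookup (lookup (lookup Z x) y) z

module TotalCyclicOrder {m} (Z : Ternary m) (isTCO : IsTotalCyclicOrder Z) where

  private
    c : Fin m → Fin m → ℕ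
    c = content Z

  rotate : ∀ {x y z} → Z ∋⟨ x , y , z ⟩ → Z ∋⟨ y , z , x ⟩
  rotate = proj₁ (proj₂ isTCO) _ _ _

  rotate² : ∀ {x y z} → Z ∋⟨ x , y , z ⟩ → Z ∋⟨ z , x , y ⟩
  rotate² = rotate ∘ rotate

  asym : ∀ {x y z} → Z ∋⟨ x , y , z ⟩ → ¬ Z ∋⟨ z , y , x ⟩
  asym = proj₁ (proj₂ (proj₂ isTCO)) _ _ _

  transitive : ∀ {x y z u} → Z ∋⟨ x , y , z ⟩ → Z ∋⟨ x , z , u ⟩ → Z ∋⟨ x , y , u ⟩
  transitive = proj₁ (proj₂ (proj₂ (proj₂ isTCO))) _ _ _ _

  ≢₁₂ : ∀ {x y z} → Z ∋⟨ x , y , z ⟩ → x ≢ y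
  ≢₁₂ xyz = proj₁ (proj₁ isTCO _ _ _ xyz)

  ≢₂₃ : ∀ {x y z} → Z ∋⟨ x , y , z ⟩ → y ≢ z
  ≢₂₃ xyz = proj₁ (proj₂ (proj₁ isTCO _ _ _ xyz))

  ≢₁₃ : ∀ {x y z} → Z ∋⟨ x , y , z ⟩ → x ≢ z
  ≢₁₃ xyz = proj₂ (proj₂ (proj₁ isTCO _ _ _ xyz))

  compare : ∀ q {x y} → x ≢ y → q ≢ x → q ≢ y → Z ∋⟨ q , x , y ⟩ ⊎ Z ∋⟨ q , y , x ⟩
  compare q {x} {y} x≢y q≢x q≢y with proj₂ (proj₂ (proj₂ (proj₂ isTCO))) q x y q≢x x≢y q≢y
  ... | inj₁ qxy = inj₁ qxy
  ... | inj₂ yxq = inj₂ (rotate² yxq)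

  forget-base : ∀ {q x y z} → Z ∋⟨ q , x , y ⟩ → Z ∋⟨ q , y , z ⟩ → Z ∋⟨ x , y , z ⟩
  forget-base qxy qyz = rotate² (transitive (rotate qyz) (rotate² qxy))

  content-<ʳ : ∀ {q x y} → Z ∋⟨ q , x , y ⟩ → c q x < c q y
  content-<ʳ {q} {x} {y} qxy = count-< (λ u → T? (ent Z q u x)) (λ u → T? (ent Z q u y))
    (λ u qux → transitive qux qxy) (allFinList m) (∈-allFinList x) qxy (λ qxx → ≢₂₃ qxx refl)

  content-<ˡ : ∀ {q x y} → Z ∋⟨ q , x , y ⟩ → c y q < c x q
  content-<ˡ {q} {x} {y} qxy = count-< (λ u → T? (ent Z y u q)) (λ u → T? (ent Z x u q))
    (λ u yuq → rotate (transitive qxy (rotate² yuq))) (allFinList m) (∈-allFinList y) (rotate qxy) (λ yyq → ≢₁₂ yyq refl)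

  content-injectiveʳ : ∀ {b x y} → x ≢ b → y ≢ b → c b x ≡ c b y → x ≡ y
  content-injectiveʳ {b} {x} {y} x≢b y≢b cx≡cy with x ≟ᶠ y
  ... | yes x≡y = x≡y
  ... | no x≢y with compare b x≢y (x≢b ∘ sym) (y≢b ∘ sym)
  ...   | inj₁ bxy = ⊥-elim (<⇒≢ (content-<ʳ bxy) cx≡cy)
  ...   | inj₂ byx = ⊥-elim (<⇒≢ (content-<ʳ byx) (sym cx≡cy))

  content-injectiveˡ : ∀ {b x y} → x ≢ b → y ≢ b → c x b ≡ c y b → x ≡ y
  content-injectiveˡ {b} {x} {y} x≢b y≢b cx≡cy with x ≟ᶠ y
  ... | yes x≡y = x≡y
  ... | no x≢y with compare b x≢y (x≢b ∘ sym) (y≢b ∘ sym)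
  ...   | inj₁ bxy = ⊥-elim (<⇒≢ (content-<ˡ bxy) (sym cx≡cy))
  ...   | inj₂ byx = ⊥-elim (<⇒≢ (content-<ˡ byx) cx≡cy)

  -- Besides the elements strictly between a and b, the m elements include b and a.
  content-bound : ∀ {a b} → a ≢ b → suc (suc (c a b)) ≤ m
  content-bound {a} {b} a≢b = subst (suc (suc (c a b)) ≤_) (length-allFinList m)
      (≤-trans (≤-trans (s≤s c<cb) cb<cba) (length-filter P3? (allFinList m)))
    where
    P1? = λ u → T? (ent Z a u b)
    P2? = λ u → P1? u ⊎-dec (u ≟ᶠ b)
    P3? = λ u → P2? u ⊎-dec (u ≟ᶠ a)
    c<cb : c a b < count P2? (allFinList m)
    c<cb = count-< P1? P2? (λ _ → inj₁) (allFinList m) (∈-allFinList b) (inj₂ refl) (λ abb → ≢₂₃ abb refl)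
    cb<cba : count P2? (allFinList m) < count P3? (allFinList m)
    cb<cba = count-< P2? P3? (λ _ → inj₁) (allFinList m) (∈-allFinList a) (inj₂ refl)
      λ { (inj₁ aab) → ≢₁₂ aab refl ; (inj₂ a≡b) → a≢b a≡b }

-- A total cyclic order is determined by the linear order it induces on the
-- other elements when read from a base point q.
module _ {m} (Z Z′ : Ternary m) (isTCO : IsTotalCyclicOrder Z) (isTCO′ : IsTotalCyclicOrder Z′) (q : Fin m)
  (Z⊆Z′ : ∀ u v → Z ∋⟨ q , u , v ⟩ → Z′ ∋⟨ q , u , v ⟩) where

  private
    module Z = TotalCyclicOrder Z isTCO
    module Z′ = TotalCyclicOrder Z′ isTCO′

    _≺[_]_ : Fin m → Ternary m → Fin m → Set
    u ≺[ W ] v = (u ≡ q × v ≢ q) ⊎ W ∋⟨ q , u , v ⟩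

    ≺-∋ : ∀ W → IsTotalCyclicOrder W → ∀ {x y z} → x ≺[ W ] y → y ≺[ W ] z → W ∋⟨ x , y , z ⟩
    ≺-∋ W isW (inj₁ (refl , y≢q)) (inj₁ (refl , _)) = ⊥-elim (y≢q refl)
    ≺-∋ W isW (inj₁ (refl , _))   (inj₂ qyz)        = qyz
    ≺-∋ W isW (inj₂ qxy)          (inj₁ (refl , _)) = ⊥-elim (TotalCyclicOrder.≢₁₃ W isW qxy refl)
    ≺-∋ W isW (inj₂ qxy)          (inj₂ qyz)        = TotalCyclicOrder.forget-base W isW qxy qyz

    ≺-total : ∀ {x y} → x ≢ y → x ≺[ Z ] y ⊎ y ≺[ Z ] x
    ≺-total {x} {y} x≢y with x ≟ᶠ q | y ≟ᶠ q
    ... | yes refl | _        = inj₁ (inj₁ (refl , x≢y ∘ sym))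
    ... | no x≢q   | yes refl = inj₂ (inj₁ (refl , x≢q))
    ... | no x≢q   | no y≢q   with Z.compare q x≢y (x≢q ∘ sym) (y≢q ∘ sym)
    ...   | inj₁ qxy = inj₁ (inj₂ qxy)
    ...   | inj₂ qyx = inj₂ (inj₂ qyx)

    transport : ∀ {u v} → u ≺[ Z ] v → u ≺[ Z′ ] v
    transport (inj₁ u≡q) = inj₁ u≡q
    transport (inj₂ quv) = inj₂ (Z⊆Z′ _ _ quv)

  ⊆-from-base : ∀ x y z → Z ∋⟨ x , y , z ⟩ → Z′ ∋⟨ x , y , z ⟩
  ⊆-from-base x y z xyz with ≺-total (Z.≢₁₂ xyz) | ≺-total (Z.≢₂₃ xyz) | ≺-total (Z.≢₁₃ xyz ∘ sym)
  ... | inj₁ x≺y | inj₁ y≺z | _        = ≺-∋ Z′ isTCO′ (transport x≺y) (transport y≺z)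
  ... | _        | inj₁ y≺z | inj₁ z≺x = Z′.rotate² (≺-∋ Z′ isTCO′ (transport y≺z) (transport z≺x))
  ... | inj₁ x≺y | _        | inj₁ z≺x = Z′.rotate (≺-∋ Z′ isTCO′ (transport z≺x) (transport x≺y))
  ... | inj₁ x≺y | inj₂ z≺y | inj₂ x≺z = ⊥-elim (Z.asym xyz (Z.rotate (≺-∋ Z isTCO x≺z z≺y)))
  ... | inj₂ y≺x | inj₁ y≺z | inj₂ x≺z = ⊥-elim (Z.asym xyz (Z.rotate² (≺-∋ Z isTCO y≺x x≺z)))
  ... | inj₂ y≺x | inj₂ z≺y | _        = ⊥-elim (Z.asym xyz (≺-∋ Z isTCO z≺y y≺x))

private
  T-injective : ∀ {a b : Bool} → (T a → T b) → (T b → T a) → a ≡ b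
  T-injective {false} {false} _   _   = refl
  T-injective {false} {true}  _   b⇒a = ⊥-elim (b⇒a _)
  T-injective {true}  {false} a⇒b _   = ⊥-elim (a⇒b _)
  T-injective {true}  {true}  _   _   = refl

≡-from-base : ∀ {m} (Z Z′ : Ternary m) → IsTotalCyclicOrder Z → IsTotalCyclicOrder Z′ → (q : Fin m) →
  (∀ u v → Z ∋⟨ q , u , v ⟩ → Z′ ∋⟨ q , u , v ⟩) → (∀ u v → Z′ ∋⟨ q , u , v ⟩ → Z ∋⟨ q , u , v ⟩) → Z ≡ Z′
≡-from-base Z Z′ isZ isZ′ q Z⊆Z′ Z′⊆Z =
  lookup-extensionality λ x → lookup-extensionality λ y → lookup-extensionality λ z →
    T-injective (⊆-from-base Z Z′ isZ isZ′ q Z⊆Z′ x y z) (⊆-from-base Z′ Z isZ′ isZ q Z′⊆Z x y z)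

CyclicOrder< : ℕ → ℕ → ℕ → Set
CyclicOrder< a b c = (a < b × b < c) ⊎ (b < c × c < a) ⊎ (c < a × a < b)

cyclicOrder<? : ∀ a b c → Dec (CyclicOrder< a b c)
cyclicOrder<? a b c = ((a <? b) ×-dec (b <? c)) ⊎-dec ((b <? c) ×-dec (c <? a)) ⊎-dec ((c <? a) ×-dec (a <? b))

cyclicOrder<-subst : ∀ {a a′ b b′ c c′} → a ≡ a′ → b ≡ b′ → c ≡ c′ → CyclicOrder< a b c → CyclicOrder< a′ b′ c′
cyclicOrder<-subst refl refl refl abc = abc

cyclicOrder<-rotate : ∀ {a b c} → CyclicOrder< a b c → CyclicOrder< b c a
cyclicOrder<-rotate (inj₁ abc)        = inj₂ (inj₂ abc)
cyclicOrder<-rotate (inj₂ (inj₁ bca)) = inj₁ bca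
cyclicOrder<-rotate (inj₂ (inj₂ cab)) = inj₂ (inj₁ cab)

cyclicOrder<-asym : ∀ {a b c} → CyclicOrder< a b c → ¬ CyclicOrder< c b a
cyclicOrder<-asym (inj₁ (a<b , b<c))        (inj₁ (c<b , b<a))        = <-asym a<b b<a
cyclicOrder<-asym (inj₁ (a<b , b<c))        (inj₂ (inj₁ (b<a , a<c))) = <-asym a<b b<a
cyclicOrder<-asym (inj₁ (a<b , b<c))        (inj₂ (inj₂ (a<c , c<b))) = <-asym b<c c<b
cyclicOrder<-asym (inj₂ (inj₁ (b<c , c<a))) (inj₁ (c<b , b<a))        = <-asym b<c c<b
cyclicOrder<-asym (inj₂ (inj₁ (b<c , c<a))) (inj₂ (inj₁ (b<a , a<c))) = <-asym c<a a<c
cyclicOrder<-asym (inj₂ (inj₁ (b<c , c<a))) (inj₂ (inj₂ (a<c , c<b))) = <-asym c<a a<c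
cyclicOrder<-asym (inj₂ (inj₂ (c<a , a<b))) (inj₁ (c<b , b<a))        = <-asym a<b b<a
cyclicOrder<-asym (inj₂ (inj₂ (c<a , a<b))) (inj₂ (inj₁ (b<a , a<c))) = <-asym a<b b<a
cyclicOrder<-asym (inj₂ (inj₂ (c<a , a<b))) (inj₂ (inj₂ (a<c , c<b))) = <-asym c<a a<c

cyclicOrder<-trans : ∀ {a b c d} → CyclicOrder< a b c → CyclicOrder< a c d → CyclicOrder< a b d
cyclicOrder<-trans (inj₁ (a<b , b<c))        (inj₁ (_ , c<d))          = inj₁ (a<b , <-trans b<c c<d)
cyclicOrder<-trans (inj₁ (a<b , b<c))        (inj₂ (inj₁ (c<d , d<a))) = ⊥-elim (<-asym (<-trans a<b b<c) (<-trans c<d d<a))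
cyclicOrder<-trans (inj₁ (a<b , _))          (inj₂ (inj₂ (d<a , _)))   = inj₂ (inj₂ (d<a , a<b))
cyclicOrder<-trans (inj₂ (inj₁ (_ , c<a)))   (inj₁ (a<c , _))          = ⊥-elim (<-asym c<a a<c)
cyclicOrder<-trans (inj₂ (inj₁ (b<c , _)))   (inj₂ (inj₁ (c<d , d<a))) = inj₂ (inj₁ (<-trans b<c c<d , d<a))
cyclicOrder<-trans (inj₂ (inj₁ (_ , c<a)))   (inj₂ (inj₂ (_ , a<c)))   = ⊥-elim (<-asym c<a a<c)
cyclicOrder<-trans (inj₂ (inj₂ (c<a , _)))   (inj₁ (a<c , _))          = ⊥-elim (<-asym c<a a<c)
cyclicOrder<-trans (inj₂ (inj₂ (_ , a<b)))   (inj₂ (inj₁ (_ , d<a)))   = inj₂ (inj₂ (d<a , a<b))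
cyclicOrder<-trans (inj₂ (inj₂ (c<a , _)))   (inj₂ (inj₂ (_ , a<c)))   = ⊥-elim (<-asym c<a a<c)

cyclicOrder<-total : ∀ a b c → a ≢ b → b ≢ c → a ≢ c → CyclicOrder< a b c ⊎ CyclicOrder< c b a
cyclicOrder<-total a b c a≢b b≢c a≢c with <-cmp a b | <-cmp b c
... | tri≈ _ a≡b _ | _              = ⊥-elim (a≢b a≡b)
... | _            | tri≈ _ b≡c _   = ⊥-elim (b≢c b≡c)
... | tri< a<b _ _ | tri< b<c _ _   = inj₁ (inj₁ (a<b , b<c))
... | tri> _ _ b<a | tri> _ _ c<b   = inj₂ (inj₁ (c<b , b<a))
... | tri> _ _ b<a | tri< b<c _ _ with <-cmp a c
...   | tri< a<c _ _ = inj₂ (inj₂ (inj₁ (b<a , a<c)))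
...   | tri≈ _ a≡c _ = ⊥-elim (a≢c a≡c)
...   | tri> _ _ c<a = inj₁ (inj₂ (inj₁ (b<c , c<a)))
cyclicOrder<-total a b c a≢b b≢c a≢c | tri< a<b _ _ | tri> _ _ c<b with <-cmp a c
...   | tri< a<c _ _ = inj₂ (inj₂ (inj₂ (a<c , c<b)))
...   | tri≈ _ a≡c _ = ⊥-elim (a≢c a≡c)
...   | tri> _ _ c<a = inj₁ (inj₂ (inj₂ (c<a , a<b)))

cyclicOrder<-distinct : ∀ {a b c} → CyclicOrder< a b c → a ≢ b × b ≢ c × a ≢ c
cyclicOrder<-distinct (inj₁ (a<b , b<c))        = <⇒≢ a<b , <⇒≢ b<c , <⇒≢ (<-trans a<b b<c)
cyclicOrder<-distinct (inj₂ (inj₁ (b<c , c<a))) = (<⇒≢ (<-trans b<c c<a) ∘ sym) , <⇒≢ b<c , (<⇒≢ c<a ∘ sym)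
cyclicOrder<-distinct (inj₂ (inj₂ (c<a , a<b))) = <⇒≢ a<b , (<⇒≢ (<-trans c<a a<b) ∘ sym) , (<⇒≢ c<a ∘ sym)

module Keyed {m} (key : Fin m → ℕ) where

  abstract
    fromKeys : Ternary m
    fromKeys = tabulate λ x → tabulate λ y → tabulate λ z → isYes (cyclicOrder<? (key x) (key y) (key z))

    ent-fromKeys : ∀ x y z → ent fromKeys x y z ≡ isYes (cyclicOrder<? (key x) (key y) (key z))
    ent-fromKeys x y z = begin
      lookup (lookup (lookup fromKeys x) y) z
        ≡⟨ cong (λ r → lookup (lookup r y) z) (Vec.lookup∘tabulate _ x) ⟩
      lookup (lookup (tabulate λ y → tabulate λ z → isYes (cyclicOrder<? (key x) (key y) (key z))) y) z
        ≡⟨ cong (λ r → lookup r z) (Vec.lookup∘tabulate _ y) ⟩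
      lookup (tabulate λ z → isYes (cyclicOrder<? (key x) (key y) (key z))) z
        ≡⟨ Vec.lookup∘tabulate _ z ⟩
      isYes (cyclicOrder<? (key x) (key y) (key z)) ∎
      where open ≡-Reasoning

  fromKeys⇒ : ∀ {x y z} → fromKeys ∋⟨ x , y , z ⟩ → CyclicOrder< (key x) (key y) (key z)
  fromKeys⇒ {x} {y} {z} xyz = toWitness (subst T (ent-fromKeys x y z) xyz)

  ⇒fromKeys : ∀ {x y z} → CyclicOrder< (key x) (key y) (key z) → fromKeys ∋⟨ x , y , z ⟩
  ⇒fromKeys {x} {y} {z} kxyz = subst T (sym (ent-fromKeys x y z)) (fromWitness kxyz)

  fromKeys-isTotalCyclicOrder : (∀ x y → key x ≡ key y → x ≡ y) → IsTotalCyclicOrder fromKeys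
  fromKeys-isTotalCyclicOrder key-injective = distinct , cyclic , asymmetric , transitive , total
    where
    distinct : OnlyDistinct fromKeys
    distinct x y z xyz with cyclicOrder<-distinct (fromKeys⇒ xyz)
    ... | kx≢ky , ky≢kz , kx≢kz = kx≢ky ∘ cong key , ky≢kz ∘ cong key , kx≢kz ∘ cong key
    cyclic : Cyclic fromKeys
    cyclic x y z = ⇒fromKeys ∘ cyclicOrder<-rotate ∘ fromKeys⇒
    asymmetric : Asymmetric fromKeys
    asymmetric x y z xyz zyx = cyclicOrder<-asym (fromKeys⇒ xyz) (fromKeys⇒ zyx)
    transitive : Transitive fromKeys
    transitive x y z u xyz xzu = ⇒fromKeys (cyclicOrder<-trans (fromKeys⇒ xyz) (fromKeys⇒ xzu))
    total : Total fromKeys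
    total x y z x≢y y≢z x≢z with cyclicOrder<-total (key x) (key y) (key z)
      (x≢y ∘ key-injective x y) (y≢z ∘ key-injective y z) (x≢z ∘ key-injective x z)
    ... | inj₁ kxyz = inj₁ (⇒fromKeys kxyz)
    ... | inj₂ kzyx = inj₂ (⇒fromKeys kzyx)

-- Read from b, the element x comes after exactly content Z b x others, so these
-- contents are keys for Z itself.
module ContentKey {m} (Z : Ternary m) (isTCO : IsTotalCyclicOrder Z) (b : Fin m) where
  open TotalCyclicOrder Z isTCO

  abstract
    contentKey : Fin m → ℕ
    contentKey x with x ≟ᶠ b
    ... | yes _ = 0
    ... | no _  = suc (content Z b x)

    contentKey-base : contentKey b ≡ 0
    contentKey-base with b ≟ᶠ b
    ... | yes _  = refl
    ... | no b≢b = ⊥-elim (b≢b refl)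

    contentKey-other : ∀ {x} → x ≢ b → contentKey x ≡ suc (content Z b x)
    contentKey-other {x} x≢b with x ≟ᶠ b
    ... | yes x≡b = ⊥-elim (x≢b x≡b)
    ... | no _    = refl

    contentKey-injective : ∀ x y → contentKey x ≡ contentKey y → x ≡ y
    contentKey-injective x y kx≡ky with x ≟ᶠ b | y ≟ᶠ b
    ... | yes x≡b | yes y≡b = trans x≡b (sym y≡b)
    ... | yes _   | no _    = ⊥-elim (1+n≢0 (sym kx≡ky))
    ... | no _    | yes _   = ⊥-elim (1+n≢0 kx≡ky)
    ... | no x≢b  | no y≢b  = content-injectiveʳ x≢b y≢b (suc-injective kx≡ky)

  open Keyed contentKey

  private
    keyed-isTCO : IsTotalCyclicOrder fromKeys
    keyed-isTCO = fromKeys-isTotalCyclicOrder contentKey-injective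

    ∋-from-content : ∀ {u v} → u ≢ b → v ≢ b → content Z b u < content Z b v → Z ∋⟨ b , u , v ⟩
    ∋-from-content u≢b v≢b cu<cv with compare b (λ { refl → <-irrefl refl cu<cv }) (u≢b ∘ sym) (v≢b ∘ sym)
    ... | inj₁ buv = buv
    ... | inj₂ bvu = ⊥-elim (<-asym cu<cv (content-<ʳ bvu))

    key-positive⇒≢ : ∀ u → 0 < contentKey u → u ≢ b
    key-positive⇒≢ u 0<ku refl = <-irrefl (sym contentKey-base) 0<ku

    keyed⇒Z : ∀ u v → fromKeys ∋⟨ b , u , v ⟩ → Z ∋⟨ b , u , v ⟩
    keyed⇒Z u v buv with subst (λ k → CyclicOrder< k (contentKey u) (contentKey v)) contentKey-base (fromKeys⇒ buv)
    ... | inj₂ (inj₁ (_ , ()))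
    ... | inj₂ (inj₂ (() , _))
    ... | inj₁ (0<ku , ku<kv) =
      ∋-from-content u≢b v≢b (≤-pred (subst₂ _<_ (contentKey-other u≢b) (contentKey-other v≢b) ku<kv))
      where
      u≢b = key-positive⇒≢ u 0<ku
      v≢b = key-positive⇒≢ v (<-trans 0<ku ku<kv)

    Z⇒keyed : ∀ u v → Z ∋⟨ b , u , v ⟩ → fromKeys ∋⟨ b , u , v ⟩
    Z⇒keyed u v buv = ⇒fromKeys (subst (λ k → CyclicOrder< k (contentKey u) (contentKey v)) (sym contentKey-base)
      (inj₁ (subst (0 <_) (sym (contentKey-other u≢b)) (s≤s z≤n) ,
             subst₂ _<_ (sym (contentKey-other u≢b)) (sym (contentKey-other v≢b)) (s≤s (content-<ʳ buv)))))
      where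
      u≢b = ≢₁₂ buv ∘ sym
      v≢b = ≢₁₃ buv ∘ sym

  fromKeys-contentKey : fromKeys ≡ Z
  fromKeys-contentKey = ≡-from-base fromKeys Z keyed-isTCO isTCO b keyed⇒Z Z⇒keyed

  ∋⇒cyclicOrder< : ∀ {x y z} → Z ∋⟨ x , y , z ⟩ → CyclicOrder< (contentKey x) (contentKey y) (contentKey z)
  ∋⇒cyclicOrder< xyz = fromKeys⇒ (subst (λ W → W ∋⟨ _ , _ , _ ⟩) (sym fromKeys-contentKey) xyz)

  cyclicOrder<⇒∋ : ∀ {x y z} → CyclicOrder< (contentKey x) (contentKey y) (contentKey z) → Z ∋⟨ x , y , z ⟩
  cyclicOrder<⇒∋ kxyz = subst (λ W → W ∋⟨ _ , _ , _ ⟩) fromKeys-contentKey (⇒fromKeys kxyz)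

abstract
  injective⇒surjective : ∀ {n} (g : Fin n → Fin n) → (∀ x y → g x ≡ g y → x ≡ y) → ∀ t → Σ (Fin n) λ x → g x ≡ t
  injective⇒surjective {n} g g-injective t with any? (λ x → g x ≟ᶠ t)
  ... | yes hit = hit
  injective⇒surjective {suc n} g g-injective t | no ¬hit = ⊥-elim (1+n≰n (injective⇒≤ g′-injective))
    where
    t≢g : ∀ x → t ≢ g x
    t≢g x t≡gx = ¬hit (x , sym t≡gx)
    g′ : Fin (suc n) → Fin n
    g′ x = punchOut (t≢g x)
    g′-injective : ∀ {x y} → g′ x ≡ g′ y → x ≡ y
    g′-injective {x} {y} = g-injective x y ∘ punchOut-injective (t≢g x) (t≢g y)

  -- Through punchIn b, h becomes an injection Fin n → Fin n.
  punctured-injective⇒surjective : ∀ {n} (b : Fin (suc n)) (h : Fin (suc n) → ℕ) →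
    (∀ x y → x ≢ b → y ≢ b → h x ≡ h y → x ≡ y) → (∀ x → x ≢ b → h x < n) →
    ∀ t → t < n → Σ (Fin (suc n)) λ x → x ≢ b × h x ≡ t
  punctured-injective⇒surjective {n} b h h-injective h< t t<n =
    punchIn b x , punchInᵢ≢i b x ,
    trans (sym (toℕ-fromℕ< (h< _ (punchInᵢ≢i b x)))) (trans (cong toℕ gx≡t) (toℕ-fromℕ< t<n))
    where
    g : Fin n → Fin n
    g y = fromℕ< (h< (punchIn b y) (punchInᵢ≢i b y))
    g-injective : ∀ y y′ → g y ≡ g y′ → y ≡ y′
    g-injective y y′ gy≡gy′ = punchIn-injective b y y′ (h-injective _ _ (punchInᵢ≢i b y) (punchInᵢ≢i b y′)
      (trans (sym (toℕ-fromℕ< (h< _ (punchInᵢ≢i b y)))) (trans (cong toℕ gy≡gy′) (toℕ-fromℕ< (h< _ (punchInᵢ≢i b y′))))))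
    hit : Σ (Fin n) λ x → g x ≡ fromℕ< t<n
    hit = injective⇒surjective g g-injective (fromℕ< t<n)
    x : Fin n
    x = proj₁ hit
    gx≡t : g x ≡ fromℕ< t<n
    gx≡t = proj₂ hit

abstract
  restrict : ∀ {n} → Ternary (suc n) → Ternary n
  restrict Z = tabulate λ x → tabulate λ y → tabulate λ z → ent Z (inject₁ x) (inject₁ y) (inject₁ z)

  ent-restrict : ∀ {n} (Z : Ternary (suc n)) x y z → ent (restrict Z) x y z ≡ ent Z (inject₁ x) (inject₁ y) (inject₁ z)
  ent-restrict Z x y z = begin
    lookup (lookup (lookup (restrict Z) x) y) z
      ≡⟨ cong (λ r → lookup (lookup r y) z) (Vec.lookup∘tabulate _ x) ⟩
    lookup (lookup (tabulate λ y → tabulate λ z → ent Z (inject₁ x) (inject₁ y) (inject₁ z)) y) z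
      ≡⟨ cong (λ r → lookup r z) (Vec.lookup∘tabulate _ y) ⟩
    lookup (tabulate λ z → ent Z (inject₁ x) (inject₁ y) (inject₁ z)) z
      ≡⟨ Vec.lookup∘tabulate _ z ⟩
    ent Z (inject₁ x) (inject₁ y) (inject₁ z) ∎
    where open ≡-Reasoning

module _ {n} (Z : Ternary (suc n)) where

  restrict⇒ : ∀ {x y z} → restrict Z ∋⟨ x , y , z ⟩ → Z ∋⟨ inject₁ x , inject₁ y , inject₁ z ⟩
  restrict⇒ {x} {y} {z} = subst T (ent-restrict Z x y z)

  ⇒restrict : ∀ {x y z} → Z ∋⟨ inject₁ x , inject₁ y , inject₁ z ⟩ → restrict Z ∋⟨ x , y , z ⟩
  ⇒restrict {x} {y} {z} = subst T (sym (ent-restrict Z x y z))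

  restrict-isTotalCyclicOrder : IsTotalCyclicOrder Z → IsTotalCyclicOrder (restrict Z)
  restrict-isTotalCyclicOrder (distinct , cyclic , asymmetric , transitive , total) =
    distinct′ , cyclic′ , asymmetric′ , transitive′ , total′
    where
    distinct′ : OnlyDistinct (restrict Z)
    distinct′ x y z xyz with distinct _ _ _ (restrict⇒ xyz)
    ... | x≢y , y≢z , x≢z = x≢y ∘ cong inject₁ , y≢z ∘ cong inject₁ , x≢z ∘ cong inject₁
    cyclic′ : Cyclic (restrict Z)
    cyclic′ x y z = ⇒restrict ∘ cyclic _ _ _ ∘ restrict⇒
    asymmetric′ : Asymmetric (restrict Z)
    asymmetric′ x y z xyz zyx = asymmetric _ _ _ (restrict⇒ xyz) (restrict⇒ zyx)
    transitive′ : Transitive (restrict Z)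
    transitive′ x y z u xyz xzu = ⇒restrict (transitive _ _ _ _ (restrict⇒ xyz) (restrict⇒ xzu))
    total′ : Total (restrict Z)
    total′ x y z x≢y y≢z x≢z with total (inject₁ x) (inject₁ y) (inject₁ z)
      (x≢y ∘ inject₁-injective) (y≢z ∘ inject₁-injective) (x≢z ∘ inject₁-injective)
    ... | inj₁ xyz = inj₁ (⇒restrict xyz)
    ... | inj₂ zyx = inj₂ (⇒restrict zyx)

  innerContent : Fin (suc n) → Fin (suc n) → ℕ
  innerContent a b = count (λ x → T? (ent Z a (inject₁ x) b)) (allFinList n)

  private
    content-split : ∀ a b → content Z a b ≡ innerContent a b + count (λ x → T? (ent Z a x b)) [ fromℕ n ]
    content-split a b = count-allFinList-suc (λ x → T? (ent Z a x b))

  innerContent-restrict : ∀ a b → innerContent (inject₁ a) (inject₁ b) ≡ content (restrict Z) a b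
  innerContent-restrict a b = count-cong _ _
    (λ x → subst T (sym (ent-restrict Z a x b))) (λ x → subst T (ent-restrict Z a x b)) (allFinList n)

  restrict-content≤content : ∀ a b → content (restrict Z) a b ≤ content Z (inject₁ a) (inject₁ b)
  restrict-content≤content a b = subst (_≤ content Z (inject₁ a) (inject₁ b)) (innerContent-restrict a b)
    (subst (innerContent (inject₁ a) (inject₁ b) ≤_) (sym (content-split (inject₁ a) (inject₁ b))) (m≤m+n _ _))

  content≤1+restrict-content : ∀ a b → content Z (inject₁ a) (inject₁ b) ≤ suc (content (restrict Z) a b)
  content≤1+restrict-content a b = subst (λ c → content Z a⁺ b⁺ ≤ suc c) (innerContent-restrict a b)
    (subst (_≤ suc (innerContent a⁺ b⁺)) (sym (content-split a⁺ b⁺))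
      (subst (_≤ suc (innerContent a⁺ b⁺)) (+-comm _ (innerContent a⁺ b⁺))
        (+-monoˡ-≤ (innerContent a⁺ b⁺) (count-singleton-≤-1 (λ x → T? (ent Z a⁺ x b⁺)) (fromℕ n)))))
    where
    a⁺ = inject₁ a
    b⁺ = inject₁ b

  content≡innerContent : ∀ a b → ¬ Z ∋⟨ a , fromℕ n , b ⟩ → content Z a b ≡ innerContent a b
  content≡innerContent a b ¬a⊤b = trans (content-split a b)
    (trans (cong (innerContent a b +_) (count-singleton-≡-0 (λ x → T? (ent Z a x b)) (fromℕ n) ¬a⊤b)) (+-identityʳ _))

-- Up/down permutations

module _ {n} (v : Fin (suc n)) {x : Fin n} where

  toℕ-punchIn-< : toℕ x < toℕ v → toℕ (punchIn v x) ≡ toℕ x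
  toℕ-punchIn-< x<v = go v x x<v
    where
    go : ∀ {n} (v : Fin (suc n)) (x : Fin n) → toℕ x < toℕ v → toℕ (punchIn v x) ≡ toℕ x
    go (Fin.suc v) Fin.zero    _         = refl
    go (Fin.suc v) (Fin.suc x) (s≤s x<v) = cong suc (go v x x<v)

  toℕ-punchIn-≥ : toℕ v ≤ toℕ x → toℕ (punchIn v x) ≡ suc (toℕ x)
  toℕ-punchIn-≥ v≤x = go v x v≤x
    where
    go : ∀ {n} (v : Fin (suc n)) (x : Fin n) → toℕ v ≤ toℕ x → toℕ (punchIn v x) ≡ suc (toℕ x)
    go Fin.zero    x           _         = refl
    go (Fin.suc v) (Fin.suc x) (s≤s v≤x) = cong suc (go v x v≤x)

  punchIn<⇒< : punchIn v x <ᶠ v → x <ᶠ v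
  punchIn<⇒< pv<v with toℕ x <? toℕ v
  ... | yes x<v = x<v
  ... | no x≮v  = ⊥-elim (<⇒≱ pv<v (subst (toℕ v ≤_) (sym (toℕ-punchIn-≥ (≮⇒≥ x≮v))) (≤-trans (≮⇒≥ x≮v) (n≤1+n _))))

  <⇒punchIn< : x <ᶠ v → punchIn v x <ᶠ v
  <⇒punchIn< x<v = subst (_< toℕ v) (sym (toℕ-punchIn-< x<v)) x<v

  <punchIn⇒≤ : v <ᶠ punchIn v x → toℕ v ≤ toℕ x
  <punchIn⇒≤ v<pv with toℕ x <? toℕ v
  ... | no x≮v  = ≮⇒≥ x≮v
  ... | yes x<v = ⊥-elim (<⇒≱ v<pv (subst (_≤ toℕ v) (sym (toℕ-punchIn-< x<v)) (<⇒≤ x<v)))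

  ≤⇒<punchIn : toℕ v ≤ toℕ x → v <ᶠ punchIn v x
  ≤⇒<punchIn v≤x = subst (toℕ v <_) (sym (toℕ-punchIn-≥ v≤x)) (s≤s v≤x)

punchIn-mono-< : ∀ {n} (v : Fin (suc n)) {x y : Fin n} → x <ᶠ y → punchIn v x <ᶠ punchIn v y
punchIn-mono-< v {x} {y} x<y = ≰⇒> (<⇒≱ x<y ∘ punchIn-cancel-≤ v y x)

punchIn-cancel-< : ∀ {n} (v : Fin (suc n)) {x y : Fin n} → punchIn v x <ᶠ punchIn v y → x <ᶠ y
punchIn-cancel-< v {x} {y} px<py = ≰⇒> (<⇒≱ px<py ∘ punchIn-mono-≤ v y x)

-- The condition that IsUpDown imposes on the step from the (0-based) position p to p + 1.
UpDownAt : ∀ {n} → ℕ → Fin n → Fin n → Set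
UpDownAt p a b = (p % 2 ≡ 0 → a <ᶠ b) × (¬ (p % 2 ≡ 0) → b <ᶠ a)

upDownAt-punchIn : ∀ {n p} (v : Fin (suc n)) {a b : Fin n} →
  UpDownAt p a b → UpDownAt p (punchIn v a) (punchIn v b)
upDownAt-punchIn v (up , down) = punchIn-mono-< v ∘ up , punchIn-mono-< v ∘ down

upDownAt-punchIn⁻ : ∀ {n p} (v : Fin (suc n)) {a b : Fin n} →
  UpDownAt p (punchIn v a) (punchIn v b) → UpDownAt p a b
upDownAt-punchIn⁻ v (up , down) = punchIn-cancel-< v ∘ up , punchIn-cancel-< v ∘ down

module _ {n} (σ : Vec (Fin (suc n)) (suc n)) where

  upDown-inject₁ : IsUpDown σ → ∀ p q → toℕ q ≡ suc (toℕ p) →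
    UpDownAt (toℕ p) (lookup σ (inject₁ p)) (lookup σ (inject₁ q))
  upDown-inject₁ ud p q q≡1+p = subst (λ t → UpDownAt t (lookup σ (inject₁ p)) (lookup σ (inject₁ q))) (toℕ-inject₁ p)
    (ud (inject₁ p) (inject₁ q) (trans (toℕ-inject₁ q) (trans q≡1+p (cong suc (sym (toℕ-inject₁ p))))))

  last≢inject₁ : IsPerm σ → (p : Fin n) → lookup σ (fromℕ n) ≢ lookup σ (inject₁ p)
  last≢inject₁ σ-perm p = fromℕ≢inject₁ ∘ σ-perm _ _

  standardiseInit : IsPerm σ → Vec (Fin n) n
  standardiseInit σ-perm = tabulate (λ p → punchOut (last≢inject₁ σ-perm p))

  punchIn-standardiseInit : (σ-perm : IsPerm σ) (p : Fin n) →
    punchIn (lookup σ (fromℕ n)) (lookup (standardiseInit σ-perm) p) ≡ lookup σ (inject₁ p)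
  punchIn-standardiseInit σ-perm p =
    trans (cong (punchIn _) (Vec.lookup∘tabulate _ p)) (punchIn-punchOut (last≢inject₁ σ-perm p))

  standardiseInit-isPerm : (σ-perm : IsPerm σ) → IsPerm (standardiseInit σ-perm)
  standardiseInit-isPerm σ-perm p q τp≡τq = inject₁-injective (σ-perm _ _ (begin
    lookup σ (inject₁ p)                    ≡⟨ punchIn-standardiseInit σ-perm p ⟨
    punchIn _ (lookup (standardiseInit σ-perm) p) ≡⟨ cong (punchIn _) τp≡τq ⟩
    punchIn _ (lookup (standardiseInit σ-perm) q) ≡⟨ punchIn-standardiseInit σ-perm q ⟩
    lookup σ (inject₁ q)                    ∎))
    where open ≡-Reasoning

  standardiseInit-isUpDown : (σ-perm : IsPerm σ) → IsUpDown σ → IsUpDown (standardiseInit σ-perm)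
  standardiseInit-isUpDown σ-perm ud p q q≡1+p = upDownAt-punchIn⁻ {p = toℕ p} (lookup σ (fromℕ n))
    (subst₂ (UpDownAt (toℕ p)) (sym (punchIn-standardiseInit σ-perm p)) (sym (punchIn-standardiseInit σ-perm q))
      (upDown-inject₁ ud p q q≡1+p))

appendLast : ∀ {n} → Fin (suc n) → Vec (Fin n) n → Vec (Fin (suc n)) (suc n)
appendLast v τ = Vec.map (punchIn v) τ ∷ʳ v

module _ {n} (v : Fin (suc n)) (τ : Vec (Fin n) n) where

  lookup-appendLast-inject₁ : ∀ p → lookup (appendLast v τ) (inject₁ p) ≡ punchIn v (lookup τ p)
  lookup-appendLast-inject₁ p = trans (lookup-∷ʳ-inject₁ (Vec.map (punchIn v) τ) p) (Vec.lookup-map p (punchIn v) τ)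
    where
    lookup-∷ʳ-inject₁ : ∀ {n} (xs : Vec (Fin (suc _)) n) (p : Fin n) → lookup (xs ∷ʳ v) (inject₁ p) ≡ lookup xs p
    lookup-∷ʳ-inject₁ (y ∷ xs) Fin.zero    = refl
    lookup-∷ʳ-inject₁ (y ∷ xs) (Fin.suc p) = lookup-∷ʳ-inject₁ xs p

  lookup-appendLast-last : lookup (appendLast v τ) (fromℕ n) ≡ v
  lookup-appendLast-last = go (Vec.map (punchIn v) τ)
    where
    go : ∀ {n} (xs : Vec (Fin (suc _)) n) → lookup (xs ∷ʳ v) (fromℕ n) ≡ v
    go []       = refl
    go (y ∷ xs) = go xs

  appendLast-isPerm : IsPerm τ → IsPerm (appendLast v τ)
  appendLast-isPerm τ-perm p q σp≡σq with view p | view q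
  ... | ‵fromℕ     | ‵fromℕ     = refl
  ... | ‵inject₁ p | ‵inject₁ q = cong inject₁ (τ-perm p q (punchIn-injective v _ _
        (trans (sym (lookup-appendLast-inject₁ p)) (trans σp≡σq (lookup-appendLast-inject₁ q)))))
  ... | ‵inject₁ p | ‵fromℕ     = ⊥-elim (punchInᵢ≢i v (lookup τ p)
        (trans (sym (lookup-appendLast-inject₁ p)) (trans σp≡σq lookup-appendLast-last)))
  ... | ‵fromℕ     | ‵inject₁ q = ⊥-elim (punchInᵢ≢i v (lookup τ q)
        (trans (sym (lookup-appendLast-inject₁ q)) (trans (sym σp≡σq) lookup-appendLast-last)))

  appendLast-isUpDown : IsUpDown τ →
    (∀ p → suc (toℕ p) ≡ n → UpDownAt (toℕ p) (punchIn v (lookup τ p)) v) → IsUpDown (appendLast v τ)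
  appendLast-isUpDown τ-ud last-step p q q≡1+p with view q | view p
  ... | ‵inject₁ q | ‵inject₁ p = subst₂ (UpDownAt (toℕ (inject₁ p)))
        (sym (lookup-appendLast-inject₁ p)) (sym (lookup-appendLast-inject₁ q))
        (subst (λ t → UpDownAt t (punchIn v (lookup τ p)) (punchIn v (lookup τ q))) (sym (toℕ-inject₁ p))
          (upDownAt-punchIn {p = toℕ p} v (τ-ud p q (trans (sym (toℕ-inject₁ q)) (trans q≡1+p (cong suc (toℕ-inject₁ p)))))))
  ... | ‵inject₁ q | ‵fromℕ     = ⊥-elim (<-irrefl refl (<-trans (subst (_< n) (sym (toℕ-inject₁ q)) (toℕ<n q))
        (subst (n <_) (sym (trans q≡1+p (cong suc (toℕ-fromℕ n)))) ≤-refl)))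
  ... | ‵fromℕ     | ‵fromℕ     = ⊥-elim (<-irrefl q≡1+p ≤-refl)
  ... | ‵fromℕ     | ‵inject₁ p = subst₂ (UpDownAt (toℕ (inject₁ p)))
        (sym (lookup-appendLast-inject₁ p)) (sym lookup-appendLast-last)
        (subst (λ t → UpDownAt t (punchIn v (lookup τ p)) v) (sym (toℕ-inject₁ p))
          (last-step p (trans (cong suc (sym (toℕ-inject₁ p))) (trans (sym q≡1+p) (toℕ-fromℕ n)))))

-- In 1-based terms the last two entries are t + 1 and v + 1.
lastStep⇒admissible : ∀ {k} (v : Fin (suc (suc k))) (t : Fin (suc k)) →
  UpDownAt k (punchIn v t) v → Admissible (suc k) (suc (toℕ t)) (suc (toℕ v))
lastStep⇒admissible {k} v t (up , down) with parity k
... | inj₁ (k-even , 1+k-odd) = inj₁ (1+k-odd , s≤s (punchIn<⇒< v {t} (up k-even)) , toℕ<n v)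
... | inj₂ (k-odd , 1+k-even) =
  inj₂ (1+k-even , s≤s z≤n , s≤s (<punchIn⇒≤ v {t} (down (λ k-even → even≢odd k k-even k-odd))))

admissible⇒lastStep : ∀ {k} (v : Fin (suc (suc k))) (t : Fin (suc k)) →
  Admissible (suc k) (suc (toℕ t)) (suc (toℕ v)) → UpDownAt k (punchIn v t) v
admissible⇒lastStep {k} v t adm with adm | parity k
... | inj₁ (_ , s≤s t<v , _) | inj₁ (k-even , _) = (λ _ → <⇒punchIn< v {t} t<v) , (λ k-odd → ⊥-elim (k-odd k-even))
... | inj₂ (_ , _ , s≤s v≤t) | inj₂ (k-odd , _) =
  (λ k-even → even≢odd k k-even k-odd) , (λ _ → ≤⇒<punchIn v {t} v≤t)
... | inj₁ (1+k-odd , _) | inj₂ (_ , 1+k-even) = even≢odd (suc k) 1+k-even 1+k-odd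
... | inj₂ (1+k-even , _) | inj₁ (_ , 1+k-odd) = even≢odd (suc k) 1+k-even 1+k-odd

module EntringerStep (k i : ℕ) where

  Perm : ℕ → Set
  Perm n = Vec (Fin n) n

  Predecessor : ℕ × Perm (suc k) → Set
  Predecessor (j , τ) = Admissible (suc k) j i × EntringerPred (suc k) j τ

  predecessor? : ∀ x → Dec (Predecessor x)
  predecessor? (j , τ) = admissible? (suc k) j i ×-dec entringerPred? (suc k) j τ

  lastEntry : Perm (suc k) → ℕ
  lastEntry τ = suc (toℕ (lookup τ (fromℕ k)))

  private
    is-fromℕ : ∀ {n} (p : Fin (suc n)) → suc (toℕ p) ≡ suc n → p ≡ fromℕ n
    is-fromℕ {n} p 1+p≡1+n = ≡-by-toℕ 1+p≡1+n (cong suc (toℕ-fromℕ n))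

    last-value : ∀ {n} (σ : Perm (suc n)) {i} → LastIs σ i → suc (toℕ (lookup σ (fromℕ n))) ≡ i
    last-value {n} σ σ-last = σ-last (fromℕ n) (cong suc (toℕ-fromℕ n))

  forget : (σ : Perm (suc (suc k))) → EntringerPred (suc (suc k)) i σ → ℕ × Perm (suc k)
  forget σ (σ-perm , _) = lastEntry τ , τ
    where τ = standardiseInit σ σ-perm

  forget-predecessor : ∀ σ pr → Predecessor (forget σ pr)
  forget-predecessor σ (σ-perm , σ-ud , σ-last) =
    admissible , standardiseInit-isPerm σ σ-perm , standardiseInit-isUpDown σ σ-perm σ-ud , τ-last
    where
    τ = standardiseInit σ σ-perm
    v = lookup σ (fromℕ (suc k))
    last-step : UpDownAt k (punchIn v (lookup τ (fromℕ k))) v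
    last-step = subst₂ (UpDownAt k) (sym (punchIn-standardiseInit σ σ-perm (fromℕ k))) refl
      (subst (λ t → UpDownAt t (lookup σ (inject₁ (fromℕ k))) v) (trans (toℕ-inject₁ (fromℕ k)) (toℕ-fromℕ k))
        (σ-ud (inject₁ (fromℕ k)) (fromℕ (suc k))
          (trans (toℕ-fromℕ (suc k)) (cong suc (sym (trans (toℕ-inject₁ (fromℕ k)) (toℕ-fromℕ k)))))))
    admissible : Admissible (suc k) (lastEntry τ) i
    admissible = subst (Admissible (suc k) (lastEntry τ)) (last-value σ σ-last)
      (lastStep⇒admissible v (lookup τ (fromℕ k)) last-step)
    τ-last : LastIs τ (lastEntry τ)
    τ-last p 1+p≡1+k = cong (λ p → suc (toℕ (lookup τ p))) (is-fromℕ p 1+p≡1+k)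

  forget-∈ : ∀ σ pr → forget σ pr ∈ pairs (oneTo (suc k)) (allVecs (allFinList (suc k)) (suc k))
  forget-∈ σ (σ-perm , _) = ∈-pairs (oneTo (suc k)) _ (∈-oneTo (toℕ<n _)) (∈-allVecsFin _)

  forget-injective : ∀ σ σ′ pr pr′ → forget σ pr ≡ forget σ′ pr′ → σ ≡ σ′
  forget-injective σ σ′ (σ-perm , _ , σ-last) (σ′-perm , _ , σ′-last) same = lookup-extensionality σ≗σ′
    where
    same-last : lookup σ (fromℕ (suc k)) ≡ lookup σ′ (fromℕ (suc k))
    same-last = toℕ-injective (suc-injective (trans (last-value σ σ-last) (sym (last-value σ′ σ′-last))))
    σ≗σ′ : ∀ q → lookup σ q ≡ lookup σ′ q
    σ≗σ′ q with view q
    ... | ‵fromℕ     = same-last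
    ... | ‵inject₁ p = begin
      lookup σ (inject₁ p)
        ≡⟨ punchIn-standardiseInit σ σ-perm p ⟨
      punchIn (lookup σ (fromℕ (suc k))) (lookup (standardiseInit σ σ-perm) p)
        ≡⟨ cong₂ punchIn same-last (cong (λ τ → lookup τ p) (cong proj₂ same)) ⟩
      punchIn (lookup σ′ (fromℕ (suc k))) (lookup (standardiseInit σ′ σ′-perm) p)
        ≡⟨ punchIn-standardiseInit σ′ σ′-perm p ⟩
      lookup σ′ (inject₁ p) ∎
      where open ≡-Reasoning

  private
    bounds : ∀ x → Predecessor x → 1 ≤ i × i ≤ suc (suc k)
    bounds (j , τ) (adm , _ , _ , τ-last) =
      admissible-bounds adm (subst (_≤ suc k) (last-value τ τ-last) (toℕ<n (lookup τ (fromℕ k))))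

    lastValue : ∀ x → Predecessor x → Fin (suc (suc k))
    lastValue x pr = fromℕ< (s≤s (pred-mono-≤ (proj₂ (bounds x pr))))

    suc-lastValue : ∀ x (pr : Predecessor x) → suc (toℕ (lastValue x pr)) ≡ i
    suc-lastValue x pr = trans (cong suc (toℕ-fromℕ< _)) (suc-pred i {{>-nonZero (proj₁ (bounds x pr))}})

  extend : ∀ x → Predecessor x → Perm (suc (suc k))
  extend (j , τ) pr = appendLast (lastValue (j , τ) pr) τ

  extend-entringer : ∀ x pr → EntringerPred (suc (suc k)) i (extend x pr)
  extend-entringer (j , τ) pr@(adm , τ-perm , τ-ud , τ-last) =
    appendLast-isPerm v τ τ-perm , appendLast-isUpDown v τ τ-ud last-step , σ-last
    where
    v = lastValue (j , τ) pr
    last-step : ∀ p → suc (toℕ p) ≡ suc k → UpDownAt (toℕ p) (punchIn v (lookup τ p)) v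
    last-step p 1+p≡1+k = subst (λ p → UpDownAt (toℕ p) (punchIn v (lookup τ p)) v) (sym (is-fromℕ p 1+p≡1+k))
      (subst (λ t → UpDownAt t (punchIn v (lookup τ (fromℕ k))) v) (sym (toℕ-fromℕ k))
        (admissible⇒lastStep v (lookup τ (fromℕ k))
          (subst₂ (Admissible (suc k)) (sym (last-value τ τ-last)) (sym (suc-lastValue (j , τ) pr)) adm)))
    σ-last : LastIs (appendLast v τ) i
    σ-last p 1+p≡2+k with view p
    ... | ‵fromℕ     = trans (cong (suc ∘ toℕ) (lookup-appendLast-last v τ)) (suc-lastValue (j , τ) pr)
    ... | ‵inject₁ p = ⊥-elim (<-irrefl (trans (sym (toℕ-inject₁ p)) (suc-injective 1+p≡2+k)) (toℕ<n p))

  extend-injective : ∀ x x′ pr pr′ → extend x pr ≡ extend x′ pr′ → x ≡ x′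
  extend-injective (j , τ) (j′ , τ′) pr@(_ , _ , _ , τ-last) pr′@(_ , _ , _ , τ′-last) same = cong₂ _,_ j≡j′ τ≡τ′
    where
    v = lastValue (j , τ) pr
    τ≡τ′ : τ ≡ τ′
    τ≡τ′ = lookup-extensionality λ p → punchIn-injective v _ _ (begin
      punchIn v (lookup τ p)             ≡⟨ lookup-appendLast-inject₁ v τ p ⟨
      lookup (extend (j , τ) pr) (inject₁ p) ≡⟨ cong (λ σ → lookup σ (inject₁ p)) same ⟩
      lookup (extend (j′ , τ′) pr′) (inject₁ p) ≡⟨ lookup-appendLast-inject₁ v τ′ p ⟩
      punchIn v (lookup τ′ p)            ∎)
      where open ≡-Reasoning
    j≡j′ : j ≡ j′
    j≡j′ = trans (sym (last-value τ τ-last)) (trans (cong lastEntry τ≡τ′) (last-value τ′ τ′-last))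

  entringer-step : entringer (suc (suc k)) i ≡ count predecessor? (pairs (oneTo (suc k)) (allVecs (allFinList (suc k)) (suc k)))
  entringer-step = ≤-antisym
    (count-≤-by-injection (entringerPred? (suc (suc k)) i) predecessor? (allVecsFin-unique (suc (suc k)))
      forget forget-∈ forget-predecessor forget-injective)
    (count-≤-by-injection predecessor? (entringerPred? (suc (suc k)) i)
      (pairs-unique (oneTo (suc k)) _ (oneTo-unique (suc k)) (allVecsFin-unique (suc k)))
      extend (λ x pr → ∈-allVecsFin (extend x pr)) extend-entringer extend-injective)

entringer-recurrence : ∀ k i → entringer (suc (suc k)) i ≡ nextRow (entringer (suc k)) (suc k) i
entringer-recurrence k i = trans (EntringerStep.entringer-step k i)
  (count-pairs (λ j → admissible? (suc k) j i) (entringerPred? (suc k)) (oneTo (suc k)) (allVecs (allFinList (suc k)) (suc k)))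

-- The recurrence for cyclic orders

double : ℕ → ℕ
double zero    = zero
double (suc n) = suc (suc (double n))

double-mono-≤ : ∀ {a b} → a ≤ b → double a ≤ double b
double-mono-≤ z≤n       = z≤n
double-mono-≤ (s≤s a≤b) = s≤s (s≤s (double-mono-≤ a≤b))

double-mono-< : ∀ {a b} → a < b → double a < double b
double-mono-< {a} a<b = ≤-trans (n≤1+n (suc (double a))) (double-mono-≤ a<b)

double-cancel-< : ∀ {a b} → double a < double b → a < b
double-cancel-< {a} {b} 2a<2b = ≰⇒> (<⇒≱ 2a<2b ∘ double-mono-≤)

double-injective : ∀ {a b} → double a ≡ double b → a ≡ b
double-injective {zero}  {zero}  _       = refl
double-injective {suc a} {suc b} 2a≡2b = cong suc (double-injective (suc-injective (suc-injective 2a≡2b)))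

double≢1+double : ∀ a b → double a ≢ suc (double b)
double≢1+double (suc a) (suc b) 2a≡1+2b = double≢1+double a b (suc-injective (suc-injective 2a≡1+2b))

double<1+double⇒≤ : ∀ {a b} → double a < suc (double b) → a ≤ b
double<1+double⇒≤ {zero}              _                 = z≤n
double<1+double⇒≤ {suc a} {suc b} (s≤s (s≤s 2a<1+2b)) = s≤s (double<1+double⇒≤ 2a<1+2b)

1+double<double⇒< : ∀ {a b} → suc (double b) < double a → b < a
1+double<double⇒< {suc a} {zero}  _                     = s≤s z≤n
1+double<double⇒< {suc a} {suc b} (s≤s (s≤s 1+2b<2a)) = s≤s (1+double<double⇒< 1+2b<2a)

<⇒1+double<double : ∀ {a b} → b < a → suc (double b) < double a
<⇒1+double<double {suc a} (s≤s b≤a) = s≤s (s≤s (double-mono-≤ b≤a))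

cyclicOrder<-double : ∀ {a b c} → CyclicOrder< a b c → CyclicOrder< (double a) (double b) (double c)
cyclicOrder<-double (inj₁ (p , q))        = inj₁ (double-mono-< p , double-mono-< q)
cyclicOrder<-double (inj₂ (inj₁ (p , q))) = inj₂ (inj₁ (double-mono-< p , double-mono-< q))
cyclicOrder<-double (inj₂ (inj₂ (p , q))) = inj₂ (inj₂ (double-mono-< p , double-mono-< q))

cyclicOrder<-double⁻ : ∀ {a b c} → CyclicOrder< (double a) (double b) (double c) → CyclicOrder< a b c
cyclicOrder<-double⁻ (inj₁ (p , q))        = inj₁ (double-cancel-< p , double-cancel-< q)
cyclicOrder<-double⁻ (inj₂ (inj₁ (p , q))) = inj₂ (inj₁ (double-cancel-< p , double-cancel-< q))
cyclicOrder<-double⁻ (inj₂ (inj₂ (p , q))) = inj₂ (inj₂ (double-cancel-< p , double-cancel-< q))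

module CyclicStep (k i : ℕ) where

  -- The elements n and n + 1 of [n + 1], and n, n + 1 and n + 2 of [n + 2], where n = k + 1.
  penult ult : Fin (suc (suc k))
  penult = inject₁ (fromℕ k)
  ult    = fromℕ (suc k)

  penult⁺ ult⁺ new : Fin (suc (suc (suc k)))
  penult⁺ = inject₁ penult
  ult⁺    = inject₁ ult
  new     = fromℕ (suc (suc k))

  suc-toℕ-penult : suc (toℕ penult) ≡ suc k
  suc-toℕ-penult = cong suc (trans (toℕ-inject₁ (fromℕ k)) (toℕ-fromℕ k))

  suc-toℕ-ult : suc (toℕ ult) ≡ suc (suc k)
  suc-toℕ-ult = cong suc (toℕ-fromℕ (suc k))

  suc-toℕ-penult⁺ : suc (toℕ penult⁺) ≡ suc k
  suc-toℕ-penult⁺ = trans (cong suc (toℕ-inject₁ penult)) suc-toℕ-penult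

  suc-toℕ-ult⁺ : suc (toℕ ult⁺) ≡ suc (suc k)
  suc-toℕ-ult⁺ = trans (cong suc (toℕ-inject₁ ult)) suc-toℕ-ult

  suc-toℕ-new : suc (toℕ new) ≡ suc (suc (suc k))
  suc-toℕ-new = cong suc (toℕ-fromℕ (suc (suc k)))

  penult≢ult : penult ≢ ult
  penult≢ult penult≡ult = 1+n≢n (sym (trans (sym suc-toℕ-penult) (trans (cong (suc ∘ toℕ) penult≡ult) suc-toℕ-ult)))

  ult⁺≢new : ult⁺ ≢ new
  ult⁺≢new ult⁺≡new = 1+n≢n (sym (trans (sym suc-toℕ-ult⁺) (trans (cong (suc ∘ toℕ) ult⁺≡new) suc-toℕ-new)))

  inject₁≢new : ∀ x → inject₁ x ≢ new
  inject₁≢new x x≡new = <-irrefl (trans (sym (toℕ-inject₁ x)) (trans (cong toℕ x≡new) (toℕ-fromℕ (suc (suc k))))) (toℕ<n x)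

  inject₁-above-new : ∀ x → toℕ (inject₁ x) ≢ suc (toℕ new)
  inject₁-above-new x x≡1+new = <-irrefl (trans (sym (toℕ-inject₁ x)) (trans x≡1+new suc-toℕ-new))
    (<-trans (toℕ<n x) (n<1+n (suc (suc k))))

  cond2Index : Ternary (suc (suc k)) → ℕ
  cond2Index Z with suc k % 2 ≟ 1
  ... | yes _ = suc (content Z penult ult)
  ... | no _  = suc (content Z ult penult)

  label-odd : ∀ Z → suc k % 2 ≡ 1 → cond2Index Z ≡ suc (content Z penult ult)
  label-odd Z odd with suc k % 2 ≟ 1
  ... | yes _   = refl
  ... | no ¬odd = ⊥-elim (¬odd odd)

  label-even : ∀ Z → suc k % 2 ≡ 0 → cond2Index Z ≡ suc (content Z ult penult)
  label-even Z even with suc k % 2 ≟ 1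
  ... | yes odd = even≢odd (suc k) even odd
  ... | no _    = refl

  content<1+k : ∀ (Z : Ternary (suc (suc k))) → IsTotalCyclicOrder Z → ∀ {a b} → a ≢ b → content Z a b < suc k
  content<1+k Z isTCO a≢b = ≤-pred (TotalCyclicOrder.content-bound Z isTCO a≢b)

  label-∈ : ∀ Z → IsTotalCyclicOrder Z → cond2Index Z ∈ oneTo (suc k)
  label-∈ Z isTCO with suc k % 2 ≟ 1
  ... | yes _ = ∈-oneTo (content<1+k Z isTCO penult≢ult)
  ... | no _  = ∈-oneTo (content<1+k Z isTCO (penult≢ult ∘ sym))

  Predecessor : ℕ × Ternary (suc (suc k)) → Set
  Predecessor (j , Z) = Admissible (suc k) j i × CycPred (suc k) j Z

  predecessor? : ∀ x → Dec (Predecessor x)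
  predecessor? (j , Z) = admissible? (suc k) j i ×-dec cycPred? (suc k) j Z

  -- Where the new element sits, read off the restriction: x lies between n + 1 and n + 2.
  BeforeNew : Ternary (suc (suc k)) → Fin (suc (suc k)) → Set
  BeforeNew Z x = x ≢ ult × (suc k % 2 ≡ 0 → suc (content Z ult x) < i) × (suc k % 2 ≡ 1 → i ≤ suc (content Z x ult))

  module Restriction (Zp : Ternary (suc (suc (suc k)))) (pr : CycPred (suc (suc k)) i Zp) where

    isTCO : IsTotalCyclicOrder Zp
    isTCO = proj₁ pr
    open TotalCyclicOrder Zp isTCO

    new-triple : Zp ∋⟨ penult⁺ , ult⁺ , new ⟩
    new-triple = proj₁ (proj₂ pr) penult⁺ ult⁺ new (suc-injective (trans suc-toℕ-ult⁺ (sym (cong suc suc-toℕ-penult⁺))))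
                   (suc-injective (trans suc-toℕ-new (sym (cong suc suc-toℕ-ult⁺))))

    i-even : suc k % 2 ≡ 0 → i ≡ suc (content Zp ult⁺ new)
    i-even even with parity (suc k)
    ... | inj₁ (_ , 2+k-odd) = proj₁ (proj₂ (proj₂ pr) ult⁺ new suc-toℕ-ult⁺ suc-toℕ-new) 2+k-odd
    ... | inj₂ (odd , _)     = even≢odd (suc k) even odd

    i-odd : suc k % 2 ≡ 1 → i ≡ suc (content Zp new ult⁺)
    i-odd odd with parity (suc k)
    ... | inj₂ (_ , 2+k-even) = proj₂ (proj₂ (proj₂ pr) ult⁺ new suc-toℕ-ult⁺ suc-toℕ-new) 2+k-even
    ... | inj₁ (even , _)     = even≢odd (suc k) even odd

    beforeNew⁺ : ∀ x → Zp ∋⟨ ult⁺ , inject₁ x , new ⟩ → BeforeNew (restrict Zp) x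
    beforeNew⁺ x u-x-new = (≢₁₂ u-x-new ∘ cong inject₁ ∘ sym) ,
      (λ even → subst (suc (content (restrict Zp) ult x) <_) (sym (i-even even))
         (s≤s (≤-<-trans (restrict-content≤content Zp ult x) (content-<ʳ u-x-new)))) ,
      (λ odd → subst (_≤ suc (content (restrict Zp) x ult)) (sym (i-odd odd))
         (≤-trans (content-<ˡ u-x-new) (content≤1+restrict-content Zp x ult)))

    beforeNew⁻ : ∀ x → BeforeNew (restrict Zp) x → Zp ∋⟨ ult⁺ , inject₁ x , new ⟩
    beforeNew⁻ x (x≢ult , if-even , if-odd) with compare ult⁺ (inject₁≢new x) (x≢ult ∘ inject₁-injective ∘ sym) ult⁺≢new
    ... | inj₁ u-x-new = u-x-new
    ... | inj₂ u-new-x with parity (suc k)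
    ...   | inj₁ (even , _) = ⊥-elim (<⇒≱ (if-even even) (subst (_≤ suc (content (restrict Zp) ult x)) (sym (i-even even))
              (≤-trans (content-<ʳ u-new-x) (content≤1+restrict-content Zp ult x))))
    ...   | inj₂ (odd , _)  = ⊥-elim (<⇒≱ (s≤s (≤-<-trans (restrict-content≤content Zp x ult) (content-<ˡ u-new-x)))
              (subst (_≤ suc (content (restrict Zp) x ult)) (i-odd odd) (if-odd odd)))

    restrict-predecessor : Predecessor (cond2Index (restrict Zp) , restrict Zp)
    restrict-predecessor = admissible , restrict-isTotalCyclicOrder Zp isTCO , cond1 , cond2
      where
      Z = restrict Zp
      u-new-p : Zp ∋⟨ ult⁺ , new , penult⁺ ⟩
      u-new-p = rotate new-triple
      cond1 : Cond1 Z
      cond1 a b c 1+a≡b 1+b≡c = ⇒restrict Zp (proj₁ (proj₂ pr) _ _ _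
        (trans (toℕ-inject₁ b) (trans 1+a≡b (cong suc (sym (toℕ-inject₁ a)))))
        (trans (toℕ-inject₁ c) (trans 1+b≡c (cong suc (sym (toℕ-inject₁ b))))))
      cond2 : Cond2 (cond2Index Z) Z
      cond2 a b a-penult b-ult with ≡-by-toℕ a-penult suc-toℕ-penult | ≡-by-toℕ b-ult suc-toℕ-ult
      ... | refl | refl = label-odd Z , label-even Z
      admissible : Admissible (suc k) (cond2Index Z) i
      admissible with parity (suc k)
      ... | inj₁ (even , _) = inj₂ (even , subst (1 ≤_) (sym (i-even even)) (s≤s z≤n) ,
            subst₂ _≤_ (sym (i-even even)) (sym (label-even Z even))
              (≤-pred (<-≤-trans (s≤s (content-<ʳ u-new-p)) (s≤s (content≤1+restrict-content Zp ult penult)))))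
      ... | inj₂ (odd , _)  = inj₁ (odd ,
            subst₂ _<_ (sym (label-odd Z odd)) (sym (i-odd odd))
              (s≤s (≤-<-trans (restrict-content≤content Zp penult ult) (content-<ˡ u-new-p))) ,
            subst (_≤ suc (suc k)) (sym (i-odd odd)) (≤-pred (content-bound (ult⁺≢new ∘ sym))))

  forget : ∀ Zp → CycPred (suc (suc k)) i Zp → ℕ × Ternary (suc (suc k))
  forget Zp _ = cond2Index (restrict Zp) , restrict Zp

  forget-predecessor : ∀ Zp pr → Predecessor (forget Zp pr)
  forget-predecessor = Restriction.restrict-predecessor

  forget-∈ : ∀ Zp pr → forget Zp pr ∈ pairs (oneTo (suc k)) (allTernary (suc (suc k)))
  forget-∈ Zp pr = ∈-pairs (oneTo (suc k)) _
    (label-∈ (restrict Zp) (restrict-isTotalCyclicOrder Zp (proj₁ pr))) (∈-allTernary (restrict Zp))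

  private
    ⊆-from-ult⁺ : ∀ Zp Zp′ (pr : CycPred (suc (suc k)) i Zp) (pr′ : CycPred (suc (suc k)) i Zp′) →
      restrict Zp ≡ restrict Zp′ → ∀ u v → Zp ∋⟨ ult⁺ , u , v ⟩ → Zp′ ∋⟨ ult⁺ , u , v ⟩
    ⊆-from-ult⁺ Zp Zp′ pr pr′ same u v u-u-v with view u | view v
    ... | ‵inject₁ x | ‵inject₁ y = restrict⇒ Zp′ (subst (λ Z → Z ∋⟨ ult , x , y ⟩) same (⇒restrict Zp u-u-v))
    ... | ‵fromℕ     | ‵fromℕ     = ⊥-elim (TotalCyclicOrder.≢₂₃ Zp (proj₁ pr) u-u-v refl)
    ... | ‵inject₁ x | ‵fromℕ     = Restriction.beforeNew⁻ Zp′ pr′ x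
          (subst (λ Z → BeforeNew Z x) same (Restriction.beforeNew⁺ Zp pr x u-u-v))
    ... | ‵fromℕ     | ‵inject₁ y with TotalCyclicOrder.compare Zp′ (proj₁ pr′) ult⁺
          (inject₁≢new y) (y≢ult ∘ inject₁-injective ∘ sym) ult⁺≢new
      where
      y≢ult : y ≢ ult
      y≢ult y≡ult = TotalCyclicOrder.≢₁₃ Zp (proj₁ pr) u-u-v (cong inject₁ (sym y≡ult))
    ...   | inj₂ u-new-y = u-new-y
    ...   | inj₁ u-y-new = ⊥-elim (TotalCyclicOrder.asym Zp (proj₁ pr) u-y-new′ (TotalCyclicOrder.rotate Zp (proj₁ pr) u-u-v))
      where
      u-y-new′ : Zp ∋⟨ ult⁺ , inject₁ y , new ⟩
      u-y-new′ = Restriction.beforeNew⁻ Zp pr y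
        (subst (λ Z → BeforeNew Z y) (sym same) (Restriction.beforeNew⁺ Zp′ pr′ y u-y-new))

  forget-injective : ∀ Zp Zp′ pr pr′ → forget Zp pr ≡ forget Zp′ pr′ → Zp ≡ Zp′
  forget-injective Zp Zp′ pr pr′ same = ≡-from-base Zp Zp′ (proj₁ pr) (proj₁ pr′) ult⁺
    (⊆-from-ult⁺ Zp Zp′ pr pr′ (cong proj₂ same)) (⊆-from-ult⁺ Zp′ Zp pr′ pr (sym (cong proj₂ same)))

  -- Read from n + 1, the new element n + 2 is inserted just before the point q.
  -- Condition (2) on [n + 2] prescribes the content of q; condition (1), that q does not come after n.
  record InsertionPoint (Z : Ternary (suc (suc k))) : Set where
    field
      point        : Fin (suc (suc k))
      point≢ult    : point ≢ ult
      point≤penult : content Z ult point ≤ content Z ult penult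
      i-even       : suc k % 2 ≡ 0 → suc (content Z ult point) ≡ i
      i-odd        : suc k % 2 ≡ 1 → suc (suc (content Z point ult)) ≡ i

  module Extension (j : ℕ) (Z : Ternary (suc (suc k))) (pr : Predecessor (j , Z)) where

    private
      isTCO : IsTotalCyclicOrder Z
      isTCO = proj₁ (proj₂ pr)
      cond1 : Cond1 Z
      cond1 = proj₁ (proj₂ (proj₂ pr))
      cond2 : Cond2 j Z
      cond2 = proj₂ (proj₂ (proj₂ pr))
    open TotalCyclicOrder Z isTCO
    open ContentKey Z isTCO ult

    j-odd : suc k % 2 ≡ 1 → j ≡ suc (content Z penult ult)
    j-odd = proj₁ (cond2 penult ult suc-toℕ-penult suc-toℕ-ult)

    j-even : suc k % 2 ≡ 0 → j ≡ suc (content Z ult penult)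
    j-even = proj₂ (cond2 penult ult suc-toℕ-penult suc-toℕ-ult)

    private
      insertionPoint-even : suc k % 2 ≡ 0 → 1 ≤ i → i ≤ j → InsertionPoint Z
      insertionPoint-even even 1≤i i≤j = record
        { point        = proj₁ hit
        ; point≢ult    = proj₁ (proj₂ hit)
        ; point≤penult = subst (_≤ content Z ult penult) (sym (proj₂ (proj₂ hit))) i-1≤
        ; i-even       = λ _ → trans (cong suc (proj₂ (proj₂ hit))) (suc-pred i {{>-nonZero 1≤i}})
        ; i-odd        = λ odd → even≢odd (suc k) even odd
        }
        where
        i-1≤ : pred i ≤ content Z ult penult
        i-1≤ = pred-mono-≤ (subst (i ≤_) (j-even even) i≤j)
        hit : Σ (Fin (suc (suc k))) λ x → x ≢ ult × content Z ult x ≡ pred i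
        hit = punctured-injective⇒surjective ult (content Z ult) (λ _ _ → content-injectiveʳ)
          (λ x x≢ult → content<1+k Z isTCO (x≢ult ∘ sym)) (pred i)
          (≤-<-trans i-1≤ (content<1+k Z isTCO (penult≢ult ∘ sym)))

      insertionPoint-odd : suc k % 2 ≡ 1 → j < i → i ≤ suc (suc k) → InsertionPoint Z
      insertionPoint-odd odd j<i i≤2+k = record
        { point        = q
        ; point≢ult    = q≢ult
        ; point≤penult = q≤penult
        ; i-even       = λ even → even≢odd (suc k) even odd
        ; i-odd        = λ _ → trans (cong (suc ∘ suc) cq≡i-2)
                           (trans (cong suc (suc-pred (pred i) {{>-nonZero (pred-mono-≤ 2≤i)}}))
                                  (suc-pred i {{>-nonZero (≤-trans (s≤s z≤n) 2≤i)}}))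
        }
        where
        2+c<i : suc (suc (content Z penult ult)) ≤ i
        2+c<i = subst (_< i) (j-odd odd) j<i
        2≤i : 2 ≤ i
        2≤i = ≤-trans (s≤s (s≤s z≤n)) 2+c<i
        c≤i-2 : content Z penult ult ≤ pred (pred i)
        c≤i-2 = pred-mono-≤ (pred-mono-≤ 2+c<i)
        hit : Σ (Fin (suc (suc k))) λ x → x ≢ ult × content Z x ult ≡ pred (pred i)
        hit = punctured-injective⇒surjective ult (λ x → content Z x ult) (λ _ _ → content-injectiveˡ)
          (λ x x≢ult → content<1+k Z isTCO x≢ult) (pred (pred i)) (s≤s (pred-mono-≤ (pred-mono-≤ i≤2+k)))
        q : Fin (suc (suc k))
        q = proj₁ hit
        q≢ult : q ≢ ult
        q≢ult = proj₁ (proj₂ hit)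
        cq≡i-2 : content Z q ult ≡ pred (pred i)
        cq≡i-2 = proj₂ (proj₂ hit)
        q≤penult : content Z ult q ≤ content Z ult penult
        q≤penult with q ≟ᶠ penult
        ... | yes q≡penult = ≤-reflexive (cong (content Z ult) q≡penult)
        ... | no q≢penult with compare ult q≢penult (q≢ult ∘ sym) (penult≢ult ∘ sym)
        ...   | inj₁ u-q-p = <⇒≤ (content-<ʳ u-q-p)
        ...   | inj₂ u-p-q = ⊥-elim (<⇒≱ (content-<ˡ u-p-q) (subst (content Z penult ult ≤_) (sym cq≡i-2) c≤i-2))

    insertionPoint : InsertionPoint Z
    insertionPoint with proj₁ pr
    ... | inj₁ (odd , j<i , i≤2+k) = insertionPoint-odd odd j<i i≤2+k
    ... | inj₂ (even , 1≤i , i≤j)  = insertionPoint-even even 1≤i i≤j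

    open InsertionPoint insertionPoint renaming (point to q; point≢ult to q≢ult)

    private
      cq : ℕ
      cq = content Z ult q

      contentKey-q : contentKey q ≡ suc cq
      contentKey-q = contentKey-other q≢ult

    -- Old keys are doubled; the new key 2 cq + 1 lies just below the key 2 (cq + 1) of q.
    abstract
      extendedKey : Fin (suc (suc (suc k))) → ℕ
      extendedKey u with view u
      ... | ‵fromℕ     = suc (double cq)
      ... | ‵inject₁ x = double (contentKey x)

      extendedKey-old : ∀ x → extendedKey (inject₁ x) ≡ double (contentKey x)
      extendedKey-old x rewrite view-inject₁ x = refl

      extendedKey-new : extendedKey new ≡ suc (double cq)
      extendedKey-new rewrite view-fromℕ (suc (suc k)) = refl

    extendedKey-ult⁺ : extendedKey ult⁺ ≡ 0
    extendedKey-ult⁺ = trans (extendedKey-old ult) (cong double contentKey-base)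

    extendedKey-injective : ∀ u v → extendedKey u ≡ extendedKey v → u ≡ v
    extendedKey-injective u v ku≡kv with view u | view v
    ... | ‵inject₁ x | ‵inject₁ y = cong inject₁ (contentKey-injective x y
          (double-injective (trans (sym (extendedKey-old x)) (trans ku≡kv (extendedKey-old y)))))
    ... | ‵inject₁ x | ‵fromℕ     = ⊥-elim (double≢1+double _ _ (trans (sym (extendedKey-old x)) (trans ku≡kv extendedKey-new)))
    ... | ‵fromℕ     | ‵inject₁ y = ⊥-elim (double≢1+double _ _ (trans (sym (extendedKey-old y)) (trans (sym ku≡kv) extendedKey-new)))
    ... | ‵fromℕ     | ‵fromℕ     = refl

    open Keyed extendedKey

    extended : Ternary (suc (suc (suc k)))
    extended = fromKeys

    extended-isTotalCyclicOrder : IsTotalCyclicOrder extended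
    extended-isTotalCyclicOrder = fromKeys-isTotalCyclicOrder extendedKey-injective

    private
      module Zₑ = TotalCyclicOrder extended extended-isTotalCyclicOrder

    extended⇒ : ∀ {x y z} → extended ∋⟨ inject₁ x , inject₁ y , inject₁ z ⟩ → Z ∋⟨ x , y , z ⟩
    extended⇒ {x} {y} {z} xyz = cyclicOrder<⇒∋ (cyclicOrder<-double⁻
      (cyclicOrder<-subst (extendedKey-old x) (extendedKey-old y) (extendedKey-old z) (fromKeys⇒ xyz)))

    ⇒extended : ∀ {x y z} → Z ∋⟨ x , y , z ⟩ → extended ∋⟨ inject₁ x , inject₁ y , inject₁ z ⟩
    ⇒extended {x} {y} {z} xyz = ⇒fromKeys (cyclicOrder<-subst
      (sym (extendedKey-old x)) (sym (extendedKey-old y)) (sym (extendedKey-old z)) (cyclicOrder<-double (∋⇒cyclicOrder< xyz)))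

    restrict-extended : restrict extended ≡ Z
    restrict-extended = ≡-from-base (restrict extended) Z
      (restrict-isTotalCyclicOrder extended extended-isTotalCyclicOrder) isTCO ult
      (λ _ _ → extended⇒ ∘ restrict⇒ extended) (λ _ _ → ⇒restrict extended ∘ ⇒extended)

    before-new⇒ : ∀ x → extended ∋⟨ ult⁺ , inject₁ x , new ⟩ → Z ∋⟨ ult , x , q ⟩
    before-new⇒ x u-x-new =
      to-keys (cyclicOrder<-subst extendedKey-ult⁺ (extendedKey-old x) extendedKey-new (fromKeys⇒ u-x-new))
      where
      positive : ∀ {a} → 0 < double a → 0 < a
      positive {suc a} _ = s≤s z≤n
      to-keys : CyclicOrder< 0 (double (contentKey x)) (suc (double cq)) → Z ∋⟨ ult , x , q ⟩
      to-keys (inj₁ (0<2kx , 2kx<1+2cq)) = cyclicOrder<⇒∋ (cyclicOrder<-subst (sym contentKey-base) refl (sym contentKey-q)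
        (inj₁ (positive 0<2kx , s≤s (double<1+double⇒≤ 2kx<1+2cq))))
      to-keys (inj₂ (inj₁ (_ , ())))
      to-keys (inj₂ (inj₂ (() , _)))

    before-new⇐ : ∀ x → Z ∋⟨ ult , x , q ⟩ → extended ∋⟨ ult⁺ , inject₁ x , new ⟩
    before-new⇐ x u-x-q = from-keys (cyclicOrder<-subst contentKey-base refl contentKey-q (∋⇒cyclicOrder< u-x-q))
      where
      from-keys : CyclicOrder< 0 (contentKey x) (suc cq) → extended ∋⟨ ult⁺ , inject₁ x , new ⟩
      from-keys (inj₁ (0<kx , s≤s kx≤cq)) = ⇒fromKeys (cyclicOrder<-subst
        (sym extendedKey-ult⁺) (sym (extendedKey-old x)) (sym extendedKey-new) (inj₁ (double-mono-< 0<kx , s≤s (double-mono-≤ kx≤cq))))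
      from-keys (inj₂ (inj₁ (_ , ())))
      from-keys (inj₂ (inj₂ (() , _)))

    after-new⇒ : ∀ x → extended ∋⟨ new , inject₁ x , ult⁺ ⟩ → x ≡ q ⊎ Z ∋⟨ q , x , ult ⟩
    after-new⇒ x new-x-u =
      to-keys (cyclicOrder<-subst extendedKey-new (extendedKey-old x) extendedKey-ult⁺ (fromKeys⇒ new-x-u))
      where
      q-below : cq < contentKey x → x ≡ q ⊎ Z ∋⟨ q , x , ult ⟩
      q-below cq<kx with x ≟ᶠ q
      ... | yes x≡q = inj₁ x≡q
      ... | no x≢q  = inj₂ (rotate (cyclicOrder<⇒∋ (cyclicOrder<-subst (sym contentKey-base) (sym contentKey-q) refl
            (inj₁ (s≤s z≤n , ≤∧≢⇒< cq<kx (x≢q ∘ sym ∘ contentKey-injective q x ∘ trans contentKey-q))))))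
      to-keys : CyclicOrder< (suc (double cq)) (double (contentKey x)) 0 → x ≡ q ⊎ Z ∋⟨ q , x , ult ⟩
      to-keys (inj₁ (_ , ()))
      to-keys (inj₂ (inj₁ (() , _)))
      to-keys (inj₂ (inj₂ (_ , 1+2cq<2kx))) = q-below (1+double<double⇒< 1+2cq<2kx)

    after-new⇐ : ∀ x → x ≡ q ⊎ Z ∋⟨ q , x , ult ⟩ → extended ∋⟨ new , inject₁ x , ult⁺ ⟩
    after-new⇐ x x≡q⊎q-x-u = ⇒fromKeys (cyclicOrder<-subst (sym extendedKey-new) (sym (extendedKey-old x)) (sym extendedKey-ult⁺)
      (inj₂ (inj₂ (s≤s z≤n , <⇒1+double<double (q-below x≡q⊎q-x-u)))))
      where
      from-keys : CyclicOrder< 0 (suc cq) (contentKey x) → cq < contentKey x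
      from-keys (inj₁ (_ , kq<kx))  = <⇒≤ kq<kx
      from-keys (inj₂ (inj₁ (_ , ())))
      from-keys (inj₂ (inj₂ (() , _)))
      q-below : x ≡ q ⊎ Z ∋⟨ q , x , ult ⟩ → cq < contentKey x
      q-below (inj₁ refl)  = ≤-reflexive (sym contentKey-q)
      q-below (inj₂ q-x-u) = from-keys (cyclicOrder<-subst contentKey-base contentKey-q refl (∋⇒cyclicOrder< (rotate² q-x-u)))

    content-ult⁺-new : content extended ult⁺ new ≡ cq
    content-ult⁺-new = begin
      content extended ult⁺ new
        ≡⟨ content≡innerContent extended ult⁺ new (λ u-new-new → Zₑ.≢₂₃ u-new-new refl) ⟩
      innerContent extended ult⁺ new
        ≡⟨ count-cong (λ x → T? (ent extended ult⁺ (inject₁ x) new)) (λ x → T? (ent Z ult x q))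
             before-new⇒ before-new⇐ (allFinList (suc (suc k))) ⟩
      cq ∎
      where open ≡-Reasoning

    content-new-ult⁺ : content extended new ult⁺ ≡ suc (content Z q ult)
    content-new-ult⁺ = begin
      content extended new ult⁺
        ≡⟨ content≡innerContent extended new ult⁺ (λ new-new-u → Zₑ.≢₁₂ new-new-u refl) ⟩
      innerContent extended new ult⁺
        ≡⟨ count-cong (λ x → T? (ent extended new (inject₁ x) ult⁺)) (λ x → (x ≟ᶠ q) ⊎-dec T? (ent Z q x ult))
             after-new⇒ after-new⇐ xs ⟩
      count (λ x → (x ≟ᶠ q) ⊎-dec T? (ent Z q x ult)) xs
        ≡⟨ count-⊎ (_≟ᶠ q) (λ x → T? (ent Z q x ult)) (λ { x refl q-q-u → ≢₁₂ q-q-u refl }) xs ⟩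
      count (_≟ᶠ q) xs + content Z q ult
        ≡⟨ cong (_+ content Z q ult) (count-≡-1 _≟ᶠ_ q xs (allFinList-unique _) (∈-allFinList q)) ⟩
      suc (content Z q ult) ∎
      where
      open ≡-Reasoning
      xs : List (Fin (suc (suc k)))
      xs = allFinList (suc (suc k))

    private
      extended-cond1-new : ∀ x y → toℕ y ≡ suc (toℕ x) → toℕ new ≡ suc (toℕ y) → extended ∋⟨ x , y , new ⟩
      extended-cond1-new x y 1+x≡y 1+y≡new
        with ≡-by-toℕ (trans (sym 1+x≡y) (suc-injective y-value)) suc-toℕ-penult⁺ | ≡-by-toℕ y-value suc-toℕ-ult⁺
        where
        y-value : suc (toℕ y) ≡ suc (suc k)
        y-value = trans (sym 1+y≡new) (suc-injective suc-toℕ-new)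
      ... | refl | refl = ⇒fromKeys (cyclicOrder<-subst (sym (extendedKey-old penult)) (sym extendedKey-ult⁺) (sym extendedKey-new)
            (inj₂ (inj₁ (s≤s z≤n , <⇒1+double<double (subst (cq <_) (sym (contentKey-other penult≢ult)) (s≤s point≤penult))))))

    extended-cond1 : Cond1 extended
    extended-cond1 x y z 1+x≡y 1+y≡z with view z
    ... | ‵fromℕ     = extended-cond1-new x y 1+x≡y 1+y≡z
    ... | ‵inject₁ z with view y
    ...   | ‵fromℕ     = ⊥-elim (inject₁-above-new z 1+y≡z)
    ...   | ‵inject₁ y with view x
    ...     | ‵fromℕ     = ⊥-elim (inject₁-above-new y 1+x≡y)
    ...     | ‵inject₁ x = ⇒extended (cond1 x y z
              (trans (sym (toℕ-inject₁ y)) (trans 1+x≡y (cong suc (toℕ-inject₁ x))))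
              (trans (sym (toℕ-inject₁ z)) (trans 1+y≡z (cong suc (toℕ-inject₁ y)))))

    extended-cond2 : Cond2 i extended
    extended-cond2 a b a-ult b-new with ≡-by-toℕ a-ult suc-toℕ-ult⁺ | ≡-by-toℕ b-new suc-toℕ-new | parity (suc k)
    ... | refl | refl | inj₁ (even , 2+k-odd) =
          (λ _ → trans (sym (i-even even)) (cong suc (sym content-ult⁺-new))) , (λ 2+k-even → even≢odd (suc (suc k)) 2+k-even 2+k-odd)
    ... | refl | refl | inj₂ (odd , 2+k-even) =
          (λ 2+k-odd → even≢odd (suc (suc k)) 2+k-even 2+k-odd) , (λ _ → trans (sym (i-odd odd)) (cong suc (sym content-new-ult⁺)))

  extend : ∀ x → Predecessor x → Ternary (suc (suc (suc k)))
  extend (j , Z) pr = Extension.extended j Z pr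

  extend-cycPred : ∀ x pr → CycPred (suc (suc k)) i (extend x pr)
  extend-cycPred (j , Z) pr =
    Extension.extended-isTotalCyclicOrder j Z pr , Extension.extended-cond1 j Z pr , Extension.extended-cond2 j Z pr

  extend-injective : ∀ x x′ pr pr′ → extend x pr ≡ extend x′ pr′ → x ≡ x′
  extend-injective (j , Z) (j′ , Z′) pr pr′ same = cong₂ _,_ j≡j′ Z≡Z′
    where
    Z≡Z′ : Z ≡ Z′
    Z≡Z′ = trans (sym (Extension.restrict-extended j Z pr)) (trans (cong restrict same) (Extension.restrict-extended j′ Z′ pr′))
    j≡j′ : j ≡ j′
    j≡j′ with parity (suc k)
    ... | inj₁ (even , _) = trans (Extension.j-even j Z pr even)
          (trans (cong (λ W → suc (content W ult penult)) Z≡Z′) (sym (Extension.j-even j′ Z′ pr′ even)))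
    ... | inj₂ (odd , _)  = trans (Extension.j-odd j Z pr odd)
          (trans (cong (λ W → suc (content W penult ult)) Z≡Z′) (sym (Extension.j-odd j′ Z′ pr′ odd)))

  cyclic-step : cyclicCount (suc (suc k)) i ≡ count predecessor? (pairs (oneTo (suc k)) (allTernary (suc (suc k))))
  cyclic-step = ≤-antisym
    (count-≤-by-injection (cycPred? (suc (suc k)) i) predecessor? (allTernary-unique (suc (suc (suc k))))
      forget forget-∈ forget-predecessor forget-injective)
    (count-≤-by-injection predecessor? (cycPred? (suc (suc k)) i)
      (pairs-unique (oneTo (suc k)) _ (oneTo-unique (suc k)) (allTernary-unique (suc (suc k))))
      extend (λ x pr → ∈-allTernary (extend x pr)) extend-cycPred extend-injective)

cyclicCount-recurrence : ∀ k i → cyclicCount (suc (suc k)) i ≡ nextRow (cyclicCount (suc k)) (suc k) i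
cyclicCount-recurrence k i = trans (CyclicStep.cyclic-step k i)
  (count-pairs (λ j → admissible? (suc k) j i) (cycPred? (suc k)) (oneTo (suc k)) (allTernary (suc (suc k))))

entringer-1≡cyclicCount-1 : ∀ i → entringer 1 i ≡ cyclicCount 1 i
entringer-1≡cyclicCount-1 zero          = refl
entringer-1≡cyclicCount-1 (suc zero)    = refl
entringer-1≡cyclicCount-1 (suc (suc i)) = refl

entringer≡cyclicCount : ∀ k i → entringer (suc k) i ≡ cyclicCount (suc k) i
entringer≡cyclicCount zero    i = entringer-1≡cyclicCount-1 i
entringer≡cyclicCount (suc k) i = begin
  entringer (suc (suc k)) i               ≡⟨ entringer-recurrence k i ⟩
  nextRow (entringer (suc k)) (suc k) i   ≡⟨ nextRow-cong (entringer≡cyclicCount k) (suc k) i ⟩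
  nextRow (cyclicCount (suc k)) (suc k) i ≡⟨ cyclicCount-recurrence k i ⟨
  cyclicCount (suc (suc k)) i             ∎
  where open ≡-Reasoning

corollary2 : (n i : ℕ) → 1 ≤ i → i ≤ n → entringer n i ≡ cyclicCount n i
corollary2 zero    i (s≤s _) ()
corollary2 (suc k) i _       _ = entringer≡cyclicCount k i
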